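{- Let $G=(V,E)$ be a simple graph and $\mathbf{s}=(s_1,\ldots,s_d)$, $\mathbf{a}=(a_1,\ldots,a_d)$ vectors of positive integers with $\sum_i a_is_i=|E|$. Let $S$ be a stable (independent) set in $G$. If $\max_i s_i\le \varphi(G\setminus S)$, then $G$ admits an $(\mathbf{s},\mathbf{a})$-star decomposition; in particular, $G$ admits an $(\mathbf{s},\mathbf{a})$-star decomposition in which the centers of all stars lie in $V\setminus S$.
   Context: A star of length $\ell$ is $K_{1,\ell}$, whose vertex of degree $\ell$ is its center. An $(\mathbf{s},\mathbf{a})$-star decomposition of $G$ is a partition of $E$ into the edge sets of subgraphs each isomorphic to a star, with exactly $a_i$ of them isomorphic to $K_{1,s_i}$ for each $i$. For a graph $H=(W,F)$, its edge expansion is $\varphi(H)=\min_{\emptyset\ne A\subsetneq W}\frac12\left(\frac1{|A|}+\frac1{|W\setminus A|}\right)|E_H(A,W\setminus A)|$, where $E_H(A,B)$ is the set of edges of $H$ with one endpoint in $A$ and the other in $B$. $G\setminus S$ denotes the subgraph induced on $V\setminus S$. -}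

module Defs where

open import Data.Nat using (ℕ; zero; suc; _+_; _*_; _≤_)
open import Data.Bool using (Bool; true; false; if_then_else_; _∧_; not)
open import Data.Fin using (Fin; zero; suc; _<_)
open import Data.Product using (Σ; ∃; _×_; _,_)
open import Data.Sum using (_⊎_)
open import Relation.Binary.PropositionalEquality using (_≡_)

record SimpleGraph (n : ℕ) : Set where
  field
    adj     : Fin n → Fin n → Bool
    symm    : ∀ u v → adj u v ≡ adj v u
    irrefl  : ∀ v → adj v v ≡ false
open SimpleGraph public

sumFin : (n : ℕ) → (Fin n → ℕ) → ℕ
sumFin zero    f = 0
sumFin (suc n) f = f zero + sumFin n (λ i → f (suc i))

[_] : Bool → ℕ
[ b ] = if b then 1 else 0

card : {n : ℕ} → (Fin n → Bool) → ℕ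
card {n} A = sumFin n (λ v → [ A v ])

_<ᵇ_ : {n : ℕ} → Fin n → Fin n → Bool
zero  <ᵇ zero  = false
zero  <ᵇ suc _ = true
suc _ <ᵇ zero  = false
suc u <ᵇ suc v = u <ᵇ v

numEdges : {n : ℕ} → SimpleGraph n → ℕ
numEdges {n} G = sumFin n (λ u → sumFin n (λ v → [ (u <ᵇ v) ∧ adj G u v ]))

-- |E(A,B)| : number of edges with one endpoint in A and the other in B
-- (used for disjoint A, B)
edgesBetween : {n : ℕ} → SimpleGraph n → (Fin n → Bool) → (Fin n → Bool) → ℕ
edgesBetween {n} G A B =
  sumFin n (λ u → sumFin n (λ v → [ A u ∧ (B v ∧ adj G u v) ]))

Stable : {n : ℕ} → SimpleGraph n → (Fin n → Bool) → Set
Stable G S = ∀ u v → S u ≡ true → S v ≡ true → adj G u v ≡ false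

-- "x ≤ φ(G ∖ S)", where φ is the edge expansion of the subgraph induced on
-- W = V ∖ S.  x ≤ min over A of (1/2)(1/|A| + 1/|W∖A|) |E(A, W∖A)| means the
-- inequality holds for every ∅ ≠ A ⊊ W; cleared of denominators
-- (|A|,|W∖A| > 0, |A| + |W∖A| = |W|) it reads
--     2 · x · |A| · |W∖A|  ≤  |W| · |E(A, W∖A)| .
-- (empty minimum, |W| ≤ 1, = +∞ by convention)
LeExpansionMinus : {n : ℕ} → ℕ → SimpleGraph n → (Fin n → Bool) → Set
LeExpansionMinus {n} x G S =
  (A : Fin n → Bool) →
  (∀ v → A v ≡ true → S v ≡ false) →
  (∃ λ v → A v ≡ true) →
  (∃ λ v → (A v ≡ false) × (S v ≡ false)) →            -- A ≠ W
  let W    = λ v → not (S v)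
      WmA  = λ v → not (S v) ∧ not (A v)
  in 2 * x * card A * card WmA ≤ card W * edgesBetween G A WmA

StarIndex : (d : ℕ) → (s a : Fin d → ℕ) → Set
StarIndex d s a = Σ (Fin d) λ i → Σ (Fin (a i)) λ k → Fin (s i)

record StarDecomposition {n : ℕ} (G : SimpleGraph n) (d : ℕ) (s a : Fin d → ℕ) : Set where
  field
    center : (i : Fin d) → Fin (a i) → Fin n
    leaf   : (i : Fin d) → (k : Fin (a i)) → Fin (s i) → Fin n
  Covers : StarIndex d s a → Fin n → Fin n → Set
  Covers (i , k , l) u v =
    (center i k ≡ u × leaf i k l ≡ v) ⊎ (center i k ≡ v × leaf i k l ≡ u)
  field
    isEdge : ∀ i k l → adj G (center i k) (leaf i k l) ≡ true
    covers : ∀ u v → adj G u v ≡ true → ∃ λ t → Covers t u v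
    unique : ∀ u v t t' → Covers t u v → Covers t' u v → t ≡ t'
open StarDecomposition public

CentersAvoid : {n : ℕ} {G : SimpleGraph n} {d : ℕ} {s a : Fin d → ℕ} →
  StarDecomposition G d s a → (Fin n → Bool) → Set
CentersAvoid {d = d} {a = a} D S = ∀ (i : Fin d) (k : Fin (a i)) → S (center D i k) ≡ false

-- Let s be the largest star size and W = V ∖ S, and give every u ∈ W the fair share
-- h(u)/2 = deg_S(u) + deg_W(u)/2 of the edges; as S is stable, these shares add up to |E|.
-- Centre the stars one at a time in W, each at a vertex minimising 2t − h, where t(u) is the
-- total size of the stars already centred at u; then 2t − h varies by at most 2s over W.
-- Averaging this over A × (W ∖ A) and using 2s|A||W ∖ A| ≤ |W| e(A, W ∖ A) gives e(X) ≤ t(X)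
-- for every vertex set X, while t adds up to |E|. By Hakimi's theorem G then has an orientation
-- with out-degree t(u) at every u, and the out-edges at u are shared out among the stars centred
-- at u. Hakimi's theorem is proved by deleting one edge at a time at a centre w: the sets X with
-- e(X) = t(X) are closed under intersection by submodularity, so if no edge at w were deletable,
-- the tight sets blocking the neighbours of w would meet in a tight set containing w and none of
-- its neighbours, which is impossible.

module Submission where

open import Defs

open import Data.Bool using (Bool; true; false; _∧_; _∨_; not)
open import Data.Bool.Properties
  using (∧-assoc; ∧-comm; ∧-zeroʳ; ∧-conicalˡ; ∧-conicalʳ; ∨-comm; not-injective)
open import Data.Empty using (⊥; ⊥-elim)
open import Data.Fin using (Fin; zero; suc)
import Data.Fin.Properties as Fin
open import Data.Fin.Subset.Properties using (anySubset?)
open import Data.List using (List; []; _∷_; _++_)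
import Data.List as List
import Data.List.Properties as List
open import Data.List.Membership.Propositional using (_∈_)
open import Data.List.Membership.Propositional.Properties
  using (∈-map⁺; ∈-map⁻; ∈-++⁺ˡ; ∈-++⁺ʳ; ∈-++⁻; ∈-allFin)
import Data.List.Relation.Unary.All as All
open import Data.List.Relation.Unary.AllPairs using ([]; _∷_)
open import Data.List.Relation.Unary.Any using (here; there)
open import Data.List.Relation.Unary.Unique.Propositional using (Unique)
import Data.List.Relation.Unary.Unique.Propositional.Properties as Unique
open import Data.Nat using (ℕ; zero; suc; _+_; _*_; _≤_; _<_; _≤?_; z≤n; s≤s; >-nonZero)
open import Data.Nat.ListAction using (sum)
open import Data.Nat.ListAction.Properties using (sum-++)
open import Data.Nat.Properties
open import Data.Nat.Tactic.RingSolver using (solve-∀)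
open import Data.Product using (Σ; ∃; _×_; _,_; proj₁; proj₂)
import Data.Product.Properties as Σ
open import Data.Sum using (_⊎_; inj₁; inj₂)
import Data.Vec as Vec
import Data.Vec.Properties as Vec
open import Function using (_∘_; case_of_; id)
open import Relation.Binary.Definitions using (DecidableEquality)
open import Relation.Binary.PropositionalEquality hiding ([_])
open import Relation.Nullary using (¬_; Dec; does; yes; no; ¬?)
open import Relation.Nullary.Decidable using (dec-true; dec-false; decidable-stable)
import Algebra.Properties.Semiring.Sum +-*-semiring as ∑

sumFin≗∑ : ∀ n (f : Fin n → ℕ) → sumFin n f ≡ ∑.sum f
sumFin≗∑ zero    f = refl
sumFin≗∑ (suc n) f = cong (f zero +_) (sumFin≗∑ n (f ∘ suc))

sumFin-cong : ∀ n {f g : Fin n → ℕ} → f ≗ g → sumFin n f ≡ sumFin n g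
sumFin-cong zero    f≗g = refl
sumFin-cong (suc n) f≗g = cong₂ _+_ (f≗g zero) (sumFin-cong n (f≗g ∘ suc))

sumFin-distrib-+ : ∀ n (f g : Fin n → ℕ) →
  sumFin n (λ i → f i + g i) ≡ sumFin n f + sumFin n g
sumFin-distrib-+ n f g = begin
  sumFin n (λ i → f i + g i)  ≡⟨ sumFin≗∑ n _ ⟩
  ∑.sum (λ i → f i + g i)     ≡⟨ ∑.∑-distrib-+ f g ⟩
  ∑.sum f + ∑.sum g           ≡⟨ sym (cong₂ _+_ (sumFin≗∑ n f) (sumFin≗∑ n g)) ⟩
  sumFin n f + sumFin n g     ∎
  where open ≡-Reasoning

*-distribˡ-sumFin : ∀ n c (f : Fin n → ℕ) → c * sumFin n f ≡ sumFin n (λ i → c * f i)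
*-distribˡ-sumFin n c f = begin
  c * sumFin n f               ≡⟨ cong (c *_) (sumFin≗∑ n f) ⟩
  c * ∑.sum f                  ≡⟨ ∑.*-distribˡ-sum c f ⟩
  ∑.sum (λ i → c * f i)        ≡⟨ sym (sumFin≗∑ n _) ⟩
  sumFin n (λ i → c * f i)     ∎
  where open ≡-Reasoning

sumFin-comm : ∀ n m (f : Fin n → Fin m → ℕ) →
  sumFin n (λ i → sumFin m (f i)) ≡ sumFin m (λ j → sumFin n (λ i → f i j))
sumFin-comm n m f = begin
  sumFin n (λ i → sumFin m (f i))          ≡⟨ nested n m f ⟩
  ∑.sum (λ i → ∑.sum (f i))                ≡⟨ ∑.∑-comm f ⟩
  ∑.sum (λ j → ∑.sum (λ i → f i j))        ≡⟨ sym (nested m n (λ j i → f i j)) ⟩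
  sumFin m (λ j → sumFin n (λ i → f i j))  ∎
  where
  open ≡-Reasoning
  nested : ∀ n m (g : Fin n → Fin m → ℕ) →
    sumFin n (λ i → sumFin m (g i)) ≡ ∑.sum (λ i → ∑.sum (g i))
  nested n m g = trans (sumFin-cong n (λ i → sumFin≗∑ m (g i))) (sumFin≗∑ n _)

sumFin-mono-≤ : ∀ n {f g : Fin n → ℕ} → (∀ i → f i ≤ g i) → sumFin n f ≤ sumFin n g
sumFin-mono-≤ zero    f≤g = z≤n
sumFin-mono-≤ (suc n) f≤g = +-mono-≤ (f≤g zero) (sumFin-mono-≤ n (f≤g ∘ suc))

sumFin-mono-< : ∀ n {f g : Fin n → ℕ} → (∀ i → f i ≤ g i) → ∀ j → f j < g j →
  sumFin n f < sumFin n g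
sumFin-mono-< (suc n) f≤g zero    fj<gj = +-mono-<-≤ fj<gj (sumFin-mono-≤ n (f≤g ∘ suc))
sumFin-mono-< (suc n) f≤g (suc j) fj<gj = +-mono-≤-< (f≤g zero) (sumFin-mono-< n (f≤g ∘ suc) j fj<gj)

sumFin-zero : ∀ n → sumFin n (λ _ → 0) ≡ 0
sumFin-zero zero    = refl
sumFin-zero (suc n) = sumFin-zero n

term≤sumFin : ∀ n (f : Fin n → ℕ) i → f i ≤ sumFin n f
term≤sumFin (suc n) f zero    = m≤m+n (f zero) _
term≤sumFin (suc n) f (suc i) = ≤-trans (term≤sumFin n (f ∘ suc) i) (m≤n+m _ (f zero))

sumFin-pos : ∀ n (f : Fin n → ℕ) → 0 < sumFin n f → ∃ λ i → 0 < f i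
sumFin-pos (suc n) f 0<Σ with f zero in eq
... | suc _ = zero , subst (0 <_) (sym eq) (s≤s z≤n)
... | zero with sumFin-pos n (f ∘ suc) 0<Σ
...   | i , 0<fi = suc i , 0<fi

_==_ : ∀ {n} → Fin n → Fin n → Bool
u == v = does (u Fin.≟ v)

==-refl : ∀ {n} (u : Fin n) → (u == u) ≡ true
==-refl u = dec-true (u Fin.≟ u) refl

==-≢ : ∀ {n} {u v : Fin n} → u ≢ v → (u == v) ≡ false
==-≢ {u = u} {v} = dec-false (u Fin.≟ v)

==⇒≡ : ∀ {n} {u v : Fin n} → (u == v) ≡ true → u ≡ v
==⇒≡ {u = u} {v} u==v with u Fin.≟ v
... | yes u≡v = u≡v

∧-leftComm : ∀ a b c → a ∧ (b ∧ c) ≡ b ∧ (a ∧ c)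
∧-leftComm a b c = trans (sym (∧-assoc a b c)) (trans (cong (_∧ c) (∧-comm a b)) (∧-assoc b a c))

[]-∧ : ∀ a b → [ a ∧ b ] ≡ [ a ] * [ b ]
[]-∧ false b = refl
[]-∧ true  b = sym (*-identityˡ [ b ])

[]-∧∧ : ∀ a b c → [ a ∧ (b ∧ c) ] ≡ [ a ] * ([ b ] * [ c ])
[]-∧∧ a b c = trans ([]-∧ a (b ∧ c)) (cong ([ a ] *_) ([]-∧ b c))

[]-∨-disjoint : ∀ p q → (p ≡ true → q ≡ false) → [ p ∨ q ] ≡ [ p ] + [ q ]
[]-∨-disjoint false q     _   = refl
[]-∨-disjoint true  false _   = refl
[]-∨-disjoint true  true  p→¬q = case p→¬q refl of λ ()

[]-∧-not : ∀ a p → (p ≡ true → a ≡ true) → [ a ] ≡ [ a ∧ not p ] + [ p ]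
[]-∧-not false false _   = refl
[]-∧-not true  false _   = refl
[]-∧-not true  true  _   = refl
[]-∧-not false true  p→a = case p→a refl of λ ()

[_]*-mono : ∀ a {x y} → (a ≡ true → x ≤ y) → [ a ] * x ≤ [ a ] * y
[ false ]*-mono _   = z≤n
[ true  ]*-mono x≤y = +-monoˡ-≤ 0 (x≤y refl)

[]-pos : ∀ {b} → 0 < [ b ] → b ≡ true
[]-pos {true} _ = refl

sumFin-δ : ∀ n (a : Fin n) (f : Fin n → ℕ) → sumFin n (λ i → [ i == a ] * f i) ≡ f a
sumFin-δ (suc n) zero    f = trans (cong (1 * f zero +_) (sumFin-zero n)) (trans (+-identityʳ _) (*-identityˡ _))
sumFin-δ (suc n) (suc a) f = sumFin-δ n a (f ∘ suc)

sumFin²-δ : ∀ n (a b : Fin n) (g : Fin n → Fin n → ℕ) →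
  sumFin n (λ x → sumFin n (λ y → [ x == a ] * ([ y == b ] * g x y))) ≡ g a b
sumFin²-δ n a b g = trans
  (sumFin-cong n (λ x → trans (sym (*-distribˡ-sumFin n [ x == a ] _)) (cong ([ x == a ] *_) (sumFin-δ n b (g x)))))
  (sumFin-δ n a (λ x → g x b))

<ᵇ-trichotomy : ∀ {n} (u v : Fin n) → [ u <ᵇ v ] + [ v <ᵇ u ] + [ v == u ] ≡ 1
<ᵇ-trichotomy zero    zero    = refl
<ᵇ-trichotomy zero    (suc v) = refl
<ᵇ-trichotomy (suc u) zero    = refl
<ᵇ-trichotomy (suc u) (suc v) = <ᵇ-trichotomy u v

sumFin²-symmetric : ∀ n (f : Fin n → Fin n → ℕ) → (∀ u v → f u v ≡ f v u) → (∀ u → f u u ≡ 0) →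
  sumFin n (λ u → sumFin n (f u)) ≡ 2 * sumFin n (λ u → sumFin n (λ v → [ u <ᵇ v ] * f u v))
sumFin²-symmetric n f symmetric diagonal = begin
  sumFin n (λ u → sumFin n (f u))                  ≡⟨ sumFin-cong n row ⟩
  sumFin n (λ u → sumFin n (above u) + sumFin n (below u))  ≡⟨ sumFin-distrib-+ n _ _ ⟩
  P + sumFin n (λ u → sumFin n (below u))          ≡⟨ cong (P +_) (sumFin-comm n n below) ⟩
  P + sumFin n (λ v → sumFin n (λ u → below u v))  ≡⟨ cong (P +_) (sumFin-cong n (λ v → sumFin-cong n (λ u →
                                                        cong ([ v <ᵇ u ] *_) (symmetric u v)))) ⟩
  P + P                                            ≡⟨ cong (P +_) (sym (+-identityʳ P)) ⟩
  2 * P                                            ∎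
  where
  open ≡-Reasoning
  above below : Fin n → Fin n → ℕ
  above u v = [ u <ᵇ v ] * f u v
  below u v = [ v <ᵇ u ] * f u v
  P = sumFin n (λ u → sumFin n (above u))
  row : ∀ u → sumFin n (f u) ≡ sumFin n (above u) + sumFin n (below u)
  row u = begin
    sumFin n (f u)
      ≡⟨ sumFin-cong n (λ v → trans (sym (*-identityˡ (f u v))) (cong (_* f u v) (sym (<ᵇ-trichotomy u v)))) ⟩
    sumFin n (λ v → ([ u <ᵇ v ] + [ v <ᵇ u ] + [ v == u ]) * f u v)
      ≡⟨ sumFin-cong n (λ v → trans (*-distribʳ-+ (f u v) ([ u <ᵇ v ] + [ v <ᵇ u ]) [ v == u ])
                                     (cong (_+ [ v == u ] * f u v) (*-distribʳ-+ (f u v) [ u <ᵇ v ] [ v <ᵇ u ]))) ⟩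
    sumFin n (λ v → above u v + below u v + [ v == u ] * f u v)
      ≡⟨ trans (sumFin-distrib-+ n _ _) (cong₂ _+_ (sumFin-distrib-+ n _ _) (sumFin-δ n u (f u))) ⟩
    sumFin n (above u) + sumFin n (below u) + f u u
      ≡⟨ trans (cong (sumFin n (above u) + sumFin n (below u) +_) (diagonal u)) (+-identityʳ _) ⟩
    sumFin n (above u) + sumFin n (below u) ∎

VertexSet : ℕ → Set
VertexSet n = Fin n → Bool

module _ {n : ℕ} where

  full : VertexSet n
  full _ = true

  ∁ : VertexSet n → VertexSet n
  ∁ X u = not (X u)

  infixr 7 _∩_
  infixr 6 _∪_ _∖_
  infix 4 _⊆_

  _∩_ _∪_ _∖_ : VertexSet n → VertexSet n → VertexSet n
  (X ∩ Y) u = X u ∧ Y u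
  (X ∪ Y) u = X u ∨ Y u
  (X ∖ Y) u = X u ∧ not (Y u)

  _⊆_ : VertexSet n → VertexSet n → Set
  X ⊆ Y = ∀ u → X u ≡ true → Y u ≡ true

  ∩-⊆ˡ : ∀ X Y → X ∩ Y ⊆ X
  ∩-⊆ˡ X Y u = ∧-conicalˡ (X u) (Y u)

  record Splits (D B C : VertexSet n) : Set where
    constructor splits
    field split : ∀ u → [ D u ] ≡ [ B u ] + [ C u ]

  ∪-splits : ∀ X Y → Splits (X ∪ Y) X (Y ∖ X)
  ∪-splits X Y = splits (λ u → indicator (X u) (Y u))
    where
    indicator : ∀ x y → [ x ∨ y ] ≡ [ x ] + [ y ∧ not x ]
    indicator false false = refl
    indicator false true  = refl
    indicator true  false = refl
    indicator true  true  = refl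

  ∩-∖-splits : ∀ X Y → Splits Y (X ∩ Y) (Y ∖ X)
  ∩-∖-splits X Y = splits (λ u → indicator (X u) (Y u))
    where
    indicator : ∀ x y → [ y ] ≡ [ x ∧ y ] + [ y ∧ not x ]
    indicator false false = refl
    indicator false true  = refl
    indicator true  false = refl
    indicator true  true  = refl

  weight : VertexSet n → (Fin n → ℕ) → ℕ
  weight X t = sumFin n (λ u → [ X u ] * t u)

  weight-cong : ∀ {X Y t t′} → X ≗ Y → t ≗ t′ → weight X t ≡ weight Y t′
  weight-cong X≗Y t≗t′ = sumFin-cong n (λ u → cong₂ (λ b k → [ b ] * k) (X≗Y u) (t≗t′ u))

  weight-split : ∀ {D B C} → Splits D B C → ∀ t → weight D t ≡ weight B t + weight C t
  weight-split {D} {B} {C} (splits split) t = trans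
    (sumFin-cong n (λ u → trans (cong (_* t u) (split u)) (*-distribʳ-+ (t u) [ B u ] [ C u ])))
    (sumFin-distrib-+ n _ _)

  card-split : ∀ {D B C} → Splits D B C → card D ≡ card B + card C
  card-split (splits split) = trans (sumFin-cong n split) (sumFin-distrib-+ n _ _)

  weight-distrib-+ : ∀ X f g → weight X (λ u → f u + g u) ≡ weight X f + weight X g
  weight-distrib-+ X f g =
    trans (sumFin-cong n (λ u → *-distribˡ-+ [ X u ] (f u) (g u))) (sumFin-distrib-+ n _ _)

  weight-scale : ∀ X c t → weight X (λ u → c * t u) ≡ c * weight X t
  weight-scale X c t = trans
    (sumFin-cong n (λ u → trans (sym (*-assoc [ X u ] c (t u))) 
      (trans (cong (_* t u) (*-comm [ X u ] c)) (*-assoc c [ X u ] (t u)))))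
    (sym (*-distribˡ-sumFin n c _))

  weight-δ+ : ∀ X w t → weight X (λ u → [ u == w ] + t u) ≡ [ X w ] + weight X t
  weight-δ+ X w t = trans (weight-distrib-+ X _ t)
    (cong (_+ weight X t) (trans (sumFin-cong n (λ u → *-comm [ X u ] _)) (sumFin-δ n w (λ u → [ X u ]))))

  weight-mono-≤ : ∀ X {f g} → (∀ u → X u ≡ true → f u ≤ g u) → weight X f ≤ weight X g
  weight-mono-≤ X f≤g = sumFin-mono-≤ n (λ u → [ X u ]*-mono (f≤g u))

  weight-mono-< : ∀ X {f g} → (∀ u → X u ≡ true → f u ≤ g u) → ∀ j → X j ≡ true → f j < g j →
    weight X f < weight X g
  weight-mono-< X {f} {g} f≤g j Xj fj<gj = sumFin-mono-< n (λ u → [ X u ]*-mono (f≤g u)) j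
    (subst (λ b → [ b ] * f j < [ b ] * g j) (sym Xj) (+-monoˡ-< 0 fj<gj))

  weight-const : ∀ X c → weight X (λ _ → c) ≡ c * card X
  weight-const X c = trans (sumFin-cong n (λ u → *-comm [ X u ] c)) (sym (*-distribˡ-sumFin n c _))

  weight-pairs : ∀ A B f g →
    weight A (λ u → weight B (λ v → f u + g v)) ≡ card B * weight A f + weight B g * card A
  weight-pairs A B f g = begin
    weight A (λ u → weight B (λ v → f u + g v))
      ≡⟨ weight-cong {X = A} (λ _ → refl) (λ u → trans (weight-distrib-+ B (λ _ → f u) g)
                                                     (cong (_+ weight B g) (weight-const B (f u)))) ⟩
    weight A (λ u → f u * card B + weight B g)
      ≡⟨ weight-distrib-+ A _ _ ⟩
    weight A (λ u → f u * card B) + weight A (λ _ → weight B g)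
      ≡⟨ cong₂ _+_ (trans (weight-cong {X = A} (λ _ → refl) (λ u → *-comm (f u) (card B)))
                          (weight-scale A (card B) f))
                   (weight-const A (weight B g)) ⟩
    card B * weight A f + weight B g * card A ∎
    where open ≡-Reasoning

  weight-vanishing : ∀ X t → (∀ u → X u ≡ true → t u ≡ 0) → weight X t ≡ 0
  weight-vanishing X t t≡0 = trans (sumFin-cong n pointwise) (sumFin-zero n)
    where
    pointwise : ∀ u → [ X u ] * t u ≡ 0
    pointwise u with X u in Xu
    ... | false = refl
    ... | true  = trans (*-identityˡ (t u)) (t≡0 u Xu)

  card-zero⇒weight-zero : ∀ X t → card X ≡ 0 → weight X t ≡ 0
  card-zero⇒weight-zero X t card≡0 = weight-vanishing X t (λ u Xu →
    case subst (_≤ 0) (cong [_] Xu) (subst ([ X u ] ≤_) card≡0 (term≤sumFin n (λ v → [ X v ]) u)) of λ ())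

  weight-full : ∀ t → weight full t ≡ sumFin n t
  weight-full t = sumFin-cong n (λ u → *-identityˡ (t u))

  weight-modular : ∀ X Y t → weight X t + weight Y t ≡ weight (X ∪ Y) t + weight (X ∩ Y) t
  weight-modular X Y t = begin
    weight X t + weight Y t                       ≡⟨ cong (weight X t +_) (weight-split (∩-∖-splits X Y) t) ⟩
    weight X t + (weight (X ∩ Y) t + weight (Y ∖ X) t)  ≡⟨ rearrange (weight X t) _ _ ⟩
    weight X t + weight (Y ∖ X) t + weight (X ∩ Y) t
      ≡⟨ cong (_+ weight (X ∩ Y) t) (sym (weight-split (∪-splits X Y) t)) ⟩
    weight (X ∪ Y) t + weight (X ∩ Y) t           ∎
    where
    open ≡-Reasoning
    rearrange : ∀ x i d → x + (i + d) ≡ x + d + i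
    rearrange = solve-∀

  degreeIn : SimpleGraph n → VertexSet n → Fin n → ℕ
  degreeIn G B u = sumFin n (λ v → [ B v ∧ adj G u v ])

  module _ (G : SimpleGraph n) where

    edgesBetween-weight : ∀ A B → edgesBetween G A B ≡ weight A (degreeIn G B)
    edgesBetween-weight A B = sumFin-cong n (λ u → trans
      (sumFin-cong n (λ v → []-∧ (A u) _)) (sym (*-distribˡ-sumFin n [ A u ] _)))

    edgesBetween-comm : ∀ A B → edgesBetween G A B ≡ edgesBetween G B A
    edgesBetween-comm A B = trans (sumFin-comm n n _) (sumFin-cong n (λ u → sumFin-cong n (λ v →
      cong [_] (trans (cong (λ e → A v ∧ (B u ∧ e)) (symm G v u)) (∧-leftComm (A v) (B u) _)))))

    edgesBetween-splitˡ : ∀ {D B C} → Splits D B C → ∀ A →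
      edgesBetween G D A ≡ edgesBetween G B A + edgesBetween G C A
    edgesBetween-splitˡ {D} {B} {C} split A = begin
      edgesBetween G D A                            ≡⟨ edgesBetween-weight D A ⟩
      weight D (degreeIn G A)                       ≡⟨ weight-split split _ ⟩
      weight B (degreeIn G A) + weight C (degreeIn G A)
        ≡⟨ sym (cong₂ _+_ (edgesBetween-weight B A) (edgesBetween-weight C A)) ⟩
      edgesBetween G B A + edgesBetween G C A       ∎
      where open ≡-Reasoning

    edgesBetween-splitʳ : ∀ {D B C} → Splits D B C → ∀ A →
      edgesBetween G A D ≡ edgesBetween G A B + edgesBetween G A C
    edgesBetween-splitʳ {D} {B} {C} split A = begin
      edgesBetween G A D                       ≡⟨ edgesBetween-comm A D ⟩
      edgesBetween G D A                       ≡⟨ edgesBetween-splitˡ split A ⟩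
      edgesBetween G B A + edgesBetween G C A  ≡⟨ cong₂ _+_ (edgesBetween-comm B A) (edgesBetween-comm C A) ⟩
      edgesBetween G A B + edgesBetween G A C  ∎
      where open ≡-Reasoning

    edgesBetween-mono : ∀ {A A′ B B′} → A ⊆ A′ → B ⊆ B′ →
      edgesBetween G A B ≤ edgesBetween G A′ B′
    edgesBetween-mono {A} {A′} {B} {B′} A⊆A′ B⊆B′ = sumFin-mono-≤ n (λ u → sumFin-mono-≤ n (λ v →
      pointwise (A u) (B v) (A⊆A′ u) (B⊆B′ v)))
      where
      pointwise : ∀ a b {a′ b′ e} → (a ≡ true → a′ ≡ true) → (b ≡ true → b′ ≡ true) →
        [ a ∧ (b ∧ e) ] ≤ [ a′ ∧ (b′ ∧ e) ]
      pointwise false b     _   _   = z≤n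
      pointwise true  false _   _   = z≤n
      pointwise true  true  a→a′ b→b′ rewrite a→a′ refl | b→b′ refl = ≤-refl

    edgesBetween-cong : ∀ {A A′ B B′} → A ≗ A′ → B ≗ B′ →
      edgesBetween G A B ≡ edgesBetween G A′ B′
    edgesBetween-cong A≗A′ B≗B′ = sumFin-cong n (λ u → sumFin-cong n (λ v →
      cong₂ (λ a b → [ a ∧ (b ∧ adj G u v) ]) (A≗A′ u) (B≗B′ v)))

    edgesBetween-square : ∀ {D B C} → Splits D B C → edgesBetween G D D ≡
      edgesBetween G B B + edgesBetween G B C + edgesBetween G C B + edgesBetween G C C
    edgesBetween-square {D} {B} {C} split = begin
      edgesBetween G D D                            ≡⟨ edgesBetween-splitˡ split D ⟩
      edgesBetween G B D + edgesBetween G C D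
        ≡⟨ cong₂ _+_ (edgesBetween-splitʳ split B) (edgesBetween-splitʳ split C) ⟩
      (edgesBetween G B B + edgesBetween G B C) + (edgesBetween G C B + edgesBetween G C C)
        ≡⟨ sym (+-assoc (edgesBetween G B B + edgesBetween G B C) _ _) ⟩
      edgesBetween G B B + edgesBetween G B C + edgesBetween G C B + edgesBetween G C C ∎
      where open ≡-Reasoning

    edgesBetween-submodular : ∀ X Y →
      edgesBetween G X X + edgesBetween G Y Y ≤
      edgesBetween G (X ∪ Y) (X ∪ Y) + edgesBetween G (X ∩ Y) (X ∩ Y)
    edgesBetween-submodular X Y = begin
      e X X + e Y Y                             ≡⟨ cong (e X X +_) (edgesBetween-square (∩-∖-splits X Y)) ⟩
      e X X + (e I I + e I D + e D I + e D D)
        ≤⟨ +-monoʳ-≤ (e X X) (+-monoˡ-≤ (e D D) (+-mono-≤ (+-monoʳ-≤ (e I I) I⊆X·D) D·I⊆X)) ⟩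
      e X X + (e I I + e X D + e D X + e D D)   ≡⟨ rearrange (e X X) (e I I) (e X D) (e D X) (e D D) ⟩
      e X X + e X D + e D X + e D D + e I I     ≡⟨ cong (_+ e I I) (sym (edgesBetween-square (∪-splits X Y))) ⟩
      e (X ∪ Y) (X ∪ Y) + e I I                 ∎
      where
      open ≤-Reasoning
      e = edgesBetween G
      I = X ∩ Y
      D = Y ∖ X
      I⊆X·D : e I D ≤ e X D
      I⊆X·D = edgesBetween-mono (∩-⊆ˡ X Y) (λ _ d → d)
      D·I⊆X : e D I ≤ e D X
      D·I⊆X = edgesBetween-mono {A = D} (λ _ d → d) (∩-⊆ˡ X Y)
      rearrange : ∀ a i p q d → a + (i + p + q + d) ≡ a + p + q + d + i
      rearrange = solve-∀

    edgesBetween-even : ∀ X → ∃ λ k → edgesBetween G X X ≡ 2 * k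
    edgesBetween-even X = sumFin n (λ u → sumFin n (λ v → [ u <ᵇ v ] * f u v)) ,
      sumFin²-symmetric n f
        (λ u v → cong [_] (trans (cong (λ e → X u ∧ (X v ∧ e)) (symm G u v)) (∧-leftComm (X u) (X v) _)))
        (λ u → cong [_] (trans (cong (λ e → X u ∧ (X u ∧ e)) (irrefl G u))
                               (trans (cong (X u ∧_) (∧-zeroʳ (X u))) (∧-zeroʳ (X u)))))
      where
      f : Fin n → Fin n → ℕ
      f u v = [ X u ∧ (X v ∧ adj G u v) ]

    edgesBetween-full : edgesBetween G full full ≡ 2 * numEdges G
    edgesBetween-full = trans
      (sumFin²-symmetric n (λ u v → [ adj G u v ]) (λ u v → cong [_] (symm G u v)) (λ u → cong [_] (irrefl G u)))
      (cong (2 *_) (sumFin-cong n (λ u → sumFin-cong n (λ v → sym ([]-∧ (u <ᵇ v) (adj G u v))))))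

    edgesBetween-stable : ∀ {S} → Stable G S → edgesBetween G S S ≡ 0
    edgesBetween-stable {S} stable = trans (sumFin-cong n (λ u → sumFin-cong n (λ v → no-edge u v)))
      (trans (sumFin-cong n (λ _ → sumFin-zero n)) (sumFin-zero n))
      where
      no-edge : ∀ u v → [ S u ∧ (S v ∧ adj G u v) ] ≡ 0
      no-edge u v with S u in Su | S v in Sv
      ... | false | _     = refl
      ... | true  | false = refl
      ... | true  | true  = cong [_] (stable u v Su Sv)

card-zero-or-member : ∀ {n} (X : VertexSet n) → card X ≡ 0 ⊎ ∃ λ v → X v ≡ true
card-zero-or-member {n} X with card X in cX
... | zero  = inj₁ refl
... | suc _ = let v , 0<Xv = sumFin-pos n (λ u → [ X u ]) (subst (0 <_) (sym cX) (s≤s z≤n))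
              in inj₂ (v , []-pos 0<Xv)

adj⇒edgesBetween-pos : ∀ {n} (H : SimpleGraph n) {u v} → adj H u v ≡ true → 0 < edgesBetween H full full
adj⇒edgesBetween-pos {n} H {u} {v} uv = begin-strict
  0                                             <⟨ s≤s z≤n ⟩
  1                                             ≡⟨ cong [_] (sym uv) ⟩
  [ adj H u v ]                                 ≤⟨ term≤sumFin n (λ y → [ adj H u y ]) v ⟩
  sumFin n (λ y → [ adj H u y ])                ≤⟨ term≤sumFin n (λ x → sumFin n (λ y → [ adj H x y ])) u ⟩
  edgesBetween H full full                      ∎
  where open ≤-Reasoning

stable-complement-nonempty : ∀ {n} (G : SimpleGraph n) {S} → Stable G S → 1 ≤ numEdges G →
  ∃ λ w → S w ≡ false
stable-complement-nonempty {n} G {S} stable 1≤E with sumFin-pos n _ 0<e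
  where
  0<e : 0 < edgesBetween G full full
  0<e = subst (0 <_) (sym (edgesBetween-full G)) (≤-trans (s≤s z≤n) (*-monoʳ-≤ 2 1≤E))
... | u , 0<deg-u with sumFin-pos n _ 0<deg-u
...   | v , 0<uv with S u in Su | S v in Sv
...     | false | _     = u , Su
...     | true  | false = v , Sv
...     | true  | true  = case trans (sym ([]-pos 0<uv)) (stable u v Su Sv) of λ ()

-- Deleting an edge

module _ {n : ℕ} (H : SimpleGraph n) (w v : Fin n) where

  joins : Fin n → Fin n → Bool
  joins x y = (x == w ∧ y == v) ∨ (x == v ∧ y == w)

  joins-sym : ∀ x y → joins x y ≡ joins y x
  joins-sym x y = trans (∨-comm (x == w ∧ y == v) (x == v ∧ y == w))
                        (cong₂ _∨_ (∧-comm (x == v) (y == w)) (∧-comm (x == w) (y == v)))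

  joins⇒≡ : ∀ {x y} → joins x y ≡ true → (w ≡ x × v ≡ y) ⊎ (w ≡ y × v ≡ x)
  joins⇒≡ {x} {y} j with x == w ∧ y == v in xy
  ... | true  = inj₁ (sym (==⇒≡ (∧-conicalˡ _ _ xy)) , sym (==⇒≡ (∧-conicalʳ _ _ xy)))
  ... | false = inj₂ (sym (==⇒≡ (∧-conicalʳ _ _ j)) , sym (==⇒≡ (∧-conicalˡ _ _ j)))

  deleteEdge : SimpleGraph n
  deleteEdge = record
    { adj    = λ x y → adj H x y ∧ not (joins x y)
    ; symm   = λ x y → cong₂ (λ a j → a ∧ not j) (symm H x y) (joins-sym x y)
    ; irrefl = λ x → cong (_∧ not (joins x x)) (irrefl H x)
    }

  deleteEdge-⊆ : ∀ x y → adj deleteEdge x y ≡ true → adj H x y ≡ true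
  deleteEdge-⊆ x y = ∧-conicalˡ _ _

  deleteEdge-deleted : adj deleteEdge w v ≡ false
  deleteEdge-deleted rewrite ==-refl w | ==-refl v = ∧-zeroʳ (adj H w v)

  deleteEdge-only : ∀ x y → adj H x y ≡ true → adj deleteEdge x y ≡ false →
    (w ≡ x × v ≡ y) ⊎ (w ≡ y × v ≡ x)
  deleteEdge-only x y xy xy′ rewrite xy = joins⇒≡ (not-injective xy′)

  module _ (wv : adj H w v ≡ true) where

    joins⇒adj : ∀ x y → joins x y ≡ true → adj H x y ≡ true
    joins⇒adj x y j with joins⇒≡ {x} {y} j
    ... | inj₁ (refl , refl) = wv
    ... | inj₂ (refl , refl) = trans (symm H x y) wv

    [joins] : ∀ x y → [ joins x y ] ≡ [ x == w ] * [ y == v ] + [ x == v ] * [ y == w ]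
    [joins] x y = trans ([]-∨-disjoint _ _ exclusive) (cong₂ _+_ ([]-∧ (x == w) (y == v)) ([]-∧ (x == v) (y == w)))
      where
      exclusive : (x == w ∧ y == v) ≡ true → (x == v ∧ y == w) ≡ false
      exclusive xy with ==⇒≡ {u = x} {w} (∧-conicalˡ _ _ xy)
      ... | refl = cong (_∧ y == x) (==-≢ {u = w} {v} λ { refl → case trans (sym wv) (irrefl H w) of λ () })

    [adj]-deleteEdge : ∀ x y →
      [ adj H x y ] ≡ [ adj deleteEdge x y ] + [ x == w ] * [ y == v ] + [ x == v ] * [ y == w ]
    [adj]-deleteEdge x y = begin
      [ adj H x y ]                            ≡⟨ []-∧-not (adj H x y) (joins x y) (joins⇒adj x y) ⟩
      [ adj deleteEdge x y ] + [ joins x y ]   ≡⟨ cong ([ adj deleteEdge x y ] +_) ([joins] x y) ⟩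
      [ adj deleteEdge x y ] + ([ x == w ] * [ y == v ] + [ x == v ] * [ y == w ])
        ≡⟨ sym (+-assoc [ adj deleteEdge x y ] _ _) ⟩
      [ adj deleteEdge x y ] + [ x == w ] * [ y == v ] + [ x == v ] * [ y == w ] ∎
      where open ≡-Reasoning

    edgesBetween-deleteEdge : ∀ X → edgesBetween deleteEdge X X + 2 * [ X w ∧ X v ] ≡ edgesBetween H X X
    edgesBetween-deleteEdge X = sym (begin
      edgesBetween H X X
        ≡⟨ ΣΣ-cong (λ x y → trans ([]-∧∧ (X x) (X y) _)
                                  (cong (λ k → [ X x ] * ([ X y ] * k)) ([adj]-deleteEdge x y))) ⟩
      ΣΣ (λ x y → [ X x ] * ([ X y ] * ([ adj′ x y ] + [ x == w ] * [ y == v ] + [ x == v ] * [ y == w ])))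
        ≡⟨ ΣΣ-cong (λ x y → expand [ X x ] [ X y ] [ adj′ x y ] [ x == w ] [ y == v ] [ x == v ] [ y == w ]) ⟩
      ΣΣ (λ x y → [ X x ] * ([ X y ] * [ adj′ x y ]) + [ x == w ] * ([ y == v ] * XX x y)
                                                   + [ x == v ] * ([ y == w ] * XX x y))
        ≡⟨ trans (ΣΣ-+ _ _) (cong (_+ ΣΣ (λ x y → [ x == v ] * ([ y == w ] * XX x y))) (ΣΣ-+ _ _)) ⟩
      ΣΣ (λ x y → [ X x ] * ([ X y ] * [ adj′ x y ]))
        + ΣΣ (λ x y → [ x == w ] * ([ y == v ] * XX x y)) + ΣΣ (λ x y → [ x == v ] * ([ y == w ] * XX x y))
        ≡⟨ cong₂ _+_ (cong₂ _+_ (sym (ΣΣ-cong (λ x y → []-∧∧ (X x) (X y) _))) (sumFin²-δ n w v XX))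
                     (sumFin²-δ n v w XX) ⟩
      edgesBetween deleteEdge X X + [ X w ] * [ X v ] + [ X v ] * [ X w ]
        ≡⟨ shuffle (edgesBetween deleteEdge X X) [ X w ] [ X v ] ⟩
      edgesBetween deleteEdge X X + 2 * ([ X w ] * [ X v ])
        ≡⟨ cong (λ k → edgesBetween deleteEdge X X + 2 * k) (sym ([]-∧ (X w) (X v))) ⟩
      edgesBetween deleteEdge X X + 2 * [ X w ∧ X v ] ∎)
      where
      open ≡-Reasoning
      adj′ = adj deleteEdge
      XX : Fin n → Fin n → ℕ
      XX x y = [ X x ] * [ X y ]
      ΣΣ : (Fin n → Fin n → ℕ) → ℕ
      ΣΣ f = sumFin n (λ x → sumFin n (f x))
      ΣΣ-cong : ∀ {f g} → (∀ x y → f x y ≡ g x y) → ΣΣ f ≡ ΣΣ g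
      ΣΣ-cong f≡g = sumFin-cong n (λ x → sumFin-cong n (f≡g x))
      ΣΣ-+ : ∀ f g → ΣΣ (λ x y → f x y + g x y) ≡ ΣΣ f + ΣΣ g
      ΣΣ-+ f g = trans (sumFin-cong n (λ x → sumFin-distrib-+ n (f x) (g x))) (sumFin-distrib-+ n _ _)
      expand : ∀ a b e p q r s → a * (b * (e + p * q + r * s)) ≡ a * (b * e) + p * (q * (a * b)) + r * (s * (a * b))
      expand = solve-∀
      shuffle : ∀ e a b → e + a * b + b * a ≡ e + 2 * (a * b)
      shuffle = solve-∀

-- Hakimi's orientation theorem

module _ {n : ℕ} where

  ⁅_⁆ : Fin n → VertexSet n
  ⁅ w ⁆ u = u == w

  weight-⁅⁆ : ∀ w t → weight ⁅ w ⁆ t ≡ t w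
  weight-⁅⁆ w t = sumFin-δ n w t

  ∖⁅⁆-splits : ∀ {X w} → X w ≡ true → Splits X (X ∖ ⁅ w ⁆) ⁅ w ⁆
  ∖⁅⁆-splits {X} {w} Xw = splits (λ u → []-∧-not (X u) (u == w) (λ u==w → trans (cong X (==⇒≡ u==w)) Xw))

  ⋂ : ∀ m → (Fin m → VertexSet n) → VertexSet n
  ⋂ zero    F = full
  ⋂ (suc m) F = F zero ∩ ⋂ m (F ∘ suc)

  ⋂-∋ : ∀ m (F : Fin m → VertexSet n) u → (∀ j → F j u ≡ true) → ⋂ m F u ≡ true
  ⋂-∋ zero    F u _   = refl
  ⋂-∋ (suc m) F u ∈F rewrite ∈F zero = ⋂-∋ m (F ∘ suc) u (∈F ∘ suc)

  ⋂-∌ : ∀ m (F : Fin m → VertexSet n) u j → F j u ≡ false → ⋂ m F u ≡ false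
  ⋂-∌ (suc m) F u zero    ∉Fj rewrite ∉Fj = refl
  ⋂-∌ (suc m) F u (suc j) ∉Fj = trans (cong (F zero u ∧_) (⋂-∌ m (F ∘ suc) u j ∉Fj)) (∧-zeroʳ (F zero u))

  ∀-or-counterexample : {P : VertexSet n → Set} → (∀ X → Dec (P X)) → (∀ {X Y} → X ≗ Y → P X → P Y) →
    (∀ X → P X) ⊎ ∃ λ X → ¬ P X
  ∀-or-counterexample P? resp with anySubset? (λ s → ¬? (P? (Vec.lookup s)))
  ... | yes (s , ¬Ps) = inj₂ (Vec.lookup s , ¬Ps)
  ... | no ∄ = inj₁ (λ X → resp (Vec.lookup∘tabulate X)
                                 (decidable-stable (P? _) (λ ¬PX → ∄ (Vec.tabulate X , ¬PX))))

∃-or-∀ : ∀ {n} {P Q : Fin n → Set} → (∀ v → P v ⊎ Q v) → ∃ P ⊎ (∀ v → Q v)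
∃-or-∀ {zero}  _     = inj₂ λ ()
∃-or-∀ {suc n} P⊎Q with P⊎Q zero | ∃-or-∀ (P⊎Q ∘ suc)
... | inj₁ p | _            = inj₁ (zero , p)
... | inj₂ _ | inj₁ (v , p) = inj₁ (suc v , p)
... | inj₂ q | inj₂ qs      = inj₂ λ { zero → q ; (suc v) → qs v }

-- The conditions of Hakimi's theorem for an orientation of H with out-degree t(u) at every u;
-- edgesBetween counts ordered pairs, hence the factors 2.
record Hakimi {n : ℕ} (H : SimpleGraph n) (t : Fin n → ℕ) : Set where
  field
    sparse : ∀ X → edgesBetween H X X ≤ 2 * weight X t
    total  : edgesBetween H full full ≡ 2 * weight full t

Tight : ∀ {n} → SimpleGraph n → (Fin n → ℕ) → VertexSet n → Set
Tight H t X = edgesBetween H X X ≡ 2 * weight X t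

Hakimi-resp : ∀ {n} {H : SimpleGraph n} {t t′} → t ≗ t′ → Hakimi H t → Hakimi H t′
Hakimi-resp {H = H} t≗t′ hakimi = record
  { sparse = λ X → subst (λ k → edgesBetween H X X ≤ 2 * k) (weight-cong {X = X} (λ _ → refl) t≗t′)
                         (sparse X)
  ; total  = trans total (cong (2 *_) (weight-cong (λ _ → refl) t≗t′))
  }
  where open Hakimi hakimi

module _ {n : ℕ} {H : SimpleGraph n} {t : Fin n → ℕ} (hakimi : Hakimi H t) where
  open Hakimi hakimi

  tight-∩ : ∀ X Y → Tight H t X → Tight H t Y → Tight H t (X ∩ Y)
  tight-∩ X Y tX tY = ≤-antisym (sparse (X ∩ Y)) (+-cancelˡ-≤ (2 * weight (X ∪ Y) t) _ _ (begin
    2 * weight (X ∪ Y) t + 2 * weight (X ∩ Y) t   ≡⟨ sym (*-distribˡ-+ 2 (weight (X ∪ Y) t) _) ⟩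
    2 * (weight (X ∪ Y) t + weight (X ∩ Y) t)     ≡⟨ cong (2 *_) (sym (weight-modular X Y t)) ⟩
    2 * (weight X t + weight Y t)                 ≡⟨ *-distribˡ-+ 2 (weight X t) _ ⟩
    2 * weight X t + 2 * weight Y t               ≡⟨ sym (cong₂ _+_ tX tY) ⟩
    edgesBetween H X X + edgesBetween H Y Y       ≤⟨ edgesBetween-submodular H X Y ⟩
    edgesBetween H (X ∪ Y) (X ∪ Y) + edgesBetween H (X ∩ Y) (X ∩ Y)
      ≤⟨ +-monoˡ-≤ _ (sparse (X ∪ Y)) ⟩
    2 * weight (X ∪ Y) t + edgesBetween H (X ∩ Y) (X ∩ Y) ∎))
    where open ≤-Reasoning

  tight-⋂ : ∀ m (F : Fin m → VertexSet n) → (∀ j → Tight H t (F j)) → Tight H t (⋂ m F)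
  tight-⋂ zero    F _      = total
  tight-⋂ (suc m) F tight = tight-∩ (F zero) (⋂ m (F ∘ suc)) (tight zero) (tight-⋂ m (F ∘ suc) (tight ∘ suc))

  tight-meets-neighbourhood : ∀ {X w} → 1 ≤ t w → Tight H t X → X w ≡ true →
    (∀ v → adj H w v ≡ true → X v ≡ false) → ⊥
  tight-meets-neighbourhood {X} {w} 1≤tw tX Xw isolated = <-irrefl refl (begin-strict
    2 * weight X′ t                    <⟨ *-monoʳ-< 2 (m<m+n (weight X′ t) 1≤tw) ⟩
    2 * (weight X′ t + t w)            ≡⟨ cong (2 *_) (sym weight-X) ⟩
    2 * weight X t                     ≡⟨ sym tX ⟩
    edgesBetween H X X                 ≡⟨ edges-X ⟩
    edgesBetween H X′ X′               ≤⟨ sparse X′ ⟩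
    2 * weight X′ t                    ∎)
    where
    open ≤-Reasoning
    X′ = X ∖ ⁅ w ⁆
    split = ∖⁅⁆-splits Xw
    weight-X : weight X t ≡ weight X′ t + t w
    weight-X = trans (weight-split split t) (cong (weight X′ t +_) (weight-⁅⁆ w t))
    w·X : edgesBetween H ⁅ w ⁆ X ≡ 0
    w·X = trans (edgesBetween-weight H ⁅ w ⁆ X)
      (trans (weight-⁅⁆ w (degreeIn H X)) (trans (sumFin-cong n no-neighbour) (sumFin-zero n)))
      where
      no-neighbour : ∀ v → [ X v ∧ adj H w v ] ≡ 0
      no-neighbour v with adj H w v in wv
      ... | true  = cong (λ b → [ b ∧ true ]) (isolated v wv)
      ... | false = cong [_] (∧-zeroʳ (X v))
    X′·w : edgesBetween H X′ ⁅ w ⁆ ≡ 0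
    X′·w = n≤0⇒n≡0 (begin
      edgesBetween H X′ ⁅ w ⁆   ≡⟨ edgesBetween-comm H X′ ⁅ w ⁆ ⟩
      edgesBetween H ⁅ w ⁆ X′   ≤⟨ edgesBetween-mono H {A = ⁅ w ⁆} (λ _ p → p) (∩-⊆ˡ X (∁ ⁅ w ⁆)) ⟩
      edgesBetween H ⁅ w ⁆ X    ≡⟨ w·X ⟩
      0                         ∎)
    edges-X : edgesBetween H X X ≡ edgesBetween H X′ X′
    edges-X = begin-equality
      edgesBetween H X X                                  ≡⟨ edgesBetween-splitˡ H split X ⟩
      edgesBetween H X′ X + edgesBetween H ⁅ w ⁆ X
        ≡⟨ cong₂ _+_ (edgesBetween-splitʳ H split X′) w·X ⟩
      edgesBetween H X′ X′ + edgesBetween H X′ ⁅ w ⁆ + 0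
        ≡⟨ trans (+-identityʳ _) (cong (edgesBetween H X′ X′ +_) X′·w) ⟩
      edgesBetween H X′ X′ + 0                            ≡⟨ +-identityʳ _ ⟩
      edgesBetween H X′ X′                                ∎

even-squeeze : ∀ {e} m → (∃ λ k → e ≡ 2 * k) → 2 * m < e → e ≤ 2 * (1 + m) → e ≡ 2 * (1 + m)
even-squeeze m (k , refl) 2m<2k 2k≤2+2m =
  cong (2 *_) (≤-antisym (*-cancelˡ-≤ 2 2k≤2+2m) (*-cancelˡ-< 2 m k 2m<2k))

module _ {n : ℕ} {H : SimpleGraph n} {t : Fin n → ℕ} {w : Fin n}
         (hakimi : Hakimi H (λ u → [ u == w ] + t u)) where
  open Hakimi hakimi

  private
    T : Fin n → ℕ
    T u = [ u == w ] + t u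

  deleteEdge-total : ∀ {v} → adj H w v ≡ true →
    edgesBetween (deleteEdge H w v) full full ≡ 2 * weight full t
  deleteEdge-total {v} wv = +-cancelʳ-≡ 2 _ _ (begin
    edgesBetween (deleteEdge H w v) full full + 2   ≡⟨ edgesBetween-deleteEdge H w v wv full ⟩
    edgesBetween H full full                        ≡⟨ total ⟩
    2 * weight full T                               ≡⟨ cong (2 *_) (weight-δ+ full w t) ⟩
    2 * (1 + weight full t)                         ≡⟨ *-distribˡ-+ 2 1 (weight full t) ⟩
    2 + 2 * weight full t                           ≡⟨ +-comm 2 _ ⟩
    2 * weight full t + 2                           ∎)
    where open ≡-Reasoning

  deleteEdge-sparse-or-tight : ∀ {v} → adj H w v ≡ true → ∀ X →
    edgesBetween (deleteEdge H w v) X X ≤ 2 * weight X t ⊎ (Tight H T X × X w ≡ true × X v ≡ false)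
  deleteEdge-sparse-or-tight {v} wv X
    with X w in Xw | X v in Xv | edgesBetween-deleteEdge H w v wv X | sparse X | weight-δ+ X w t
  ... | false | _     | e′+0≡e | e≤2T | T≡t = inj₁ (begin
    e′                      ≤⟨ m≤m+n e′ 0 ⟩
    e′ + 0                  ≡⟨ e′+0≡e ⟩
    edgesBetween H X X      ≤⟨ e≤2T ⟩
    2 * weight X T          ≡⟨ cong (2 *_) T≡t ⟩
    2 * weight X t          ∎)
    where
    open ≤-Reasoning
    e′ = edgesBetween (deleteEdge H w v) X X
  ... | true  | true  | e′+2≡e | e≤2T | T≡t = inj₁ (+-cancelˡ-≤ 2 _ _ (begin
    2 + e′                  ≡⟨ +-comm 2 e′ ⟩
    e′ + 2                  ≡⟨ e′+2≡e ⟩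
    edgesBetween H X X      ≤⟨ e≤2T ⟩
    2 * weight X T          ≡⟨ cong (2 *_) T≡t ⟩
    2 * (1 + weight X t)    ≡⟨ *-distribˡ-+ 2 1 (weight X t) ⟩
    2 + 2 * weight X t      ∎))
    where
    open ≤-Reasoning
    e′ = edgesBetween (deleteEdge H w v) X X
  ... | true  | false | e′+0≡e | e≤2T | T≡t with edgesBetween (deleteEdge H w v) X X ≤? 2 * weight X t
  ...   | yes e′≤2t = inj₁ e′≤2t
  ...   | no  e′≰2t = inj₂ (tight , refl , refl)
    where
    e≡e′ : edgesBetween H X X ≡ edgesBetween (deleteEdge H w v) X X
    e≡e′ = trans (sym e′+0≡e) (+-identityʳ _)
    tight : Tight H T X
    tight = trans (even-squeeze (weight X t) (edgesBetween-even H X) (subst (_ <_) (sym e≡e′) (≰⇒> e′≰2t))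
                                (subst (λ k → _ ≤ 2 * k) T≡t e≤2T))
                  (cong (2 *_) (sym T≡t))

  record Blocking (v : Fin n) : Set where
    field
      set   : VertexSet n
      tight : Tight H T set
      ∋w    : set w ≡ true
      ∌v    : adj H w v ≡ true → set v ≡ false

  deletable-or-blocked : ∀ v →
    (adj H w v ≡ true × ∀ X → edgesBetween (deleteEdge H w v) X X ≤ 2 * weight X t) ⊎ Blocking v
  deletable-or-blocked v with adj H w v in wv
  ... | false = inj₂ record
    { set = full ; tight = total ; ∋w = refl ; ∌v = λ wv′ → case trans (sym wv) wv′ of λ () }
  ... | true with ∀-or-counterexample (λ X → edgesBetween (deleteEdge H w v) X X ≤? 2 * weight X t)
                 (λ X≗Y → subst₂ _≤_ (edgesBetween-cong (deleteEdge H w v) X≗Y X≗Y)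
                                      (cong (2 *_) (weight-cong X≗Y (λ _ → refl))))
  ...   | inj₁ sparse′ = inj₁ (refl , sparse′)
  ...   | inj₂ (X , ¬sparse) with deleteEdge-sparse-or-tight wv X
  ...     | inj₁ sparse-X          = ⊥-elim (¬sparse sparse-X)
  ...     | inj₂ (tight , Xw , Xv) = inj₂ record { set = X ; tight = tight ; ∋w = Xw ; ∌v = λ _ → Xv }

  removable-edge : ∃ λ v → adj H w v ≡ true × Hakimi (deleteEdge H w v) t
  removable-edge with ∃-or-∀ deletable-or-blocked
  ... | inj₁ (v , wv , sparse′) = v , wv , record { sparse = sparse′ ; total = deleteEdge-total wv }
  ... | inj₂ blocked = ⊥-elim (tight-meets-neighbourhood hakimi 1≤Tw
                                 (tight-⋂ hakimi n Z (Blocking.tight ∘ blocked))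
                                 (⋂-∋ n Z w (Blocking.∋w ∘ blocked))
                                 (λ v wv → ⋂-∌ n Z v v (Blocking.∌v (blocked v) wv)))
    where
    Z : Fin n → VertexSet n
    Z = Blocking.set ∘ blocked
    1≤Tw : 1 ≤ T w
    1≤Tw rewrite ==-refl w = s≤s z≤n

module _ {A B : Set} (_≟ₐ_ : DecidableEquality A) where

  update : (A → B) → A → B → A → B
  update f x b y with y ≟ₐ x
  ... | yes _ = b
  ... | no  _ = f y

  update-≡ : ∀ f x b → update f x b x ≡ b
  update-≡ f x b with x ≟ₐ x
  ... | yes _  = refl
  ... | no x≢x = ⊥-elim (x≢x refl)

  update-≢ : ∀ f {x} b {y} → y ≢ x → update f x b y ≡ f y
  update-≢ f {x} b {y} y≢x with y ≟ₐ x
  ... | yes y≡x = ⊥-elim (y≢x y≡x)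
  ... | no  _   = refl

load : ∀ {n} {A : Set} → (A → Fin n) → (A → ℕ) → List A → Fin n → ℕ
load c m []       u = 0
load c m (x ∷ xs) u = m x * [ u == c x ] + load c m xs u

load-cong : ∀ {n} {A : Set} {c c′ : A → Fin n} (m : A → ℕ) xs → (∀ {x} → x ∈ xs → c x ≡ c′ x) →
  load c m xs ≗ load c′ m xs
load-cong m []       _     u = refl
load-cong m (x ∷ xs) c≡c′ u =
  cong₂ (λ w k → m x * [ u == w ] + k) (c≡c′ (here refl)) (load-cong m xs (c≡c′ ∘ there) u)

sumFin-load : ∀ {n} {A : Set} (c : A → Fin n) m xs → sumFin n (load c m xs) ≡ sum (List.map m xs)
sumFin-load {n} c m []       = sumFin-zero n
sumFin-load {n} c m (x ∷ xs) = begin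
  sumFin n (λ u → m x * [ u == c x ] + load c m xs u)
    ≡⟨ sumFin-distrib-+ n _ _ ⟩
  sumFin n (λ u → m x * [ u == c x ]) + sumFin n (load c m xs)
    ≡⟨ cong₂ _+_ (trans (sumFin-cong n (λ u → *-comm (m x) _)) (sumFin-δ n (c x) (λ _ → m x)))
                 (sumFin-load c m xs) ⟩
  m x + sum (List.map m xs) ∎
  where open ≡-Reasoning

load-vanishing : ∀ {n} {A : Set} (c : A → Fin n) m xs u → (∀ {x} → x ∈ xs → u ≢ c x) → load c m xs u ≡ 0
load-vanishing c m []       u _   = refl
load-vanishing c m (x ∷ xs) u u∉ = begin
  m x * [ u == c x ] + load c m xs u
    ≡⟨ cong₂ (λ b k → m x * [ b ] + k) (==-≢ (u∉ (here refl))) (load-vanishing c m xs u (u∉ ∘ there)) ⟩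
  m x * 0 + 0                         ≡⟨ trans (+-identityʳ _) (*-zeroʳ (m x)) ⟩
  0                                   ∎
  where open ≡-Reasoning

module _ {n : ℕ} {A : Set} (_≟ₐ_ : DecidableEquality A) (c : A → Fin n) where

  Joins : (A → Fin n) → A → Fin n → Fin n → Set
  Joins head x u v = (c x ≡ u × head x ≡ v) ⊎ (c x ≡ v × head x ≡ u)

  Joins-adj : ∀ (H : SimpleGraph n) head {x u v} → Joins head x u v → adj H u v ≡ adj H (c x) (head x)
  Joins-adj H _ (inj₁ (refl , refl)) = refl
  Joins-adj H _ (inj₂ (refl , refl)) = symm H _ _

  Joins-resp : ∀ head head′ {x u v} → head x ≡ head′ x → Joins head x u v → Joins head′ x u v
  Joins-resp _ _ eq (inj₁ (cx , hx)) = inj₁ (cx , trans (sym eq) hx)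
  Joins-resp _ _ eq (inj₂ (cx , hx)) = inj₂ (cx , trans (sym eq) hx)

  record Orientation (H : SimpleGraph n) (xs : List A) : Set where
    field
      head   : A → Fin n
      isEdge : ∀ {x} → x ∈ xs → adj H (c x) (head x) ≡ true
      covers : ∀ u v → adj H u v ≡ true → ∃ λ x → x ∈ xs × Joins head x u v
      unique : ∀ {x y u v} → x ∈ xs → y ∈ xs → Joins head x u v → Joins head y u v → x ≡ y

  orientation : ∀ xs → Unique xs → (H : SimpleGraph n) → Hakimi H (load c (λ _ → 1) xs) → Orientation H xs
  orientation [] _ H hakimi = record
    { head   = c
    ; isEdge = λ ()
    ; covers = λ u v uv → ⊥-elim (<⇒≢ (adj⇒edgesBetween-pos H uv) (sym no-edges))
    ; unique = λ ()
    }
    where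
    no-edges : edgesBetween H full full ≡ 0
    no-edges = trans (Hakimi.total hakimi) (cong (2 *_) (sumFin-zero n))
  orientation (x ∷ xs) (x∉xs ∷ unique-xs) H hakimi = record
    { head = head ; isEdge = arc-isEdge ; covers = arcs-cover ; unique = arcs-unique }
    where
    removable = removable-edge (Hakimi-resp (λ u → cong (_+ load c (λ _ → 1) xs u) (*-identityˡ _)) hakimi)
    w = c x
    v = proj₁ removable
    wv = proj₁ (proj₂ removable)
    H′ = deleteEdge H w v
    module R = Orientation (orientation xs unique-xs H′ (proj₂ (proj₂ removable)))

    head : A → Fin n
    head = update _≟ₐ_ R.head x v

    head-x : head x ≡ v
    head-x = update-≡ _≟ₐ_ R.head x v

    head-xs : ∀ {y} → y ∈ xs → head y ≡ R.head y
    head-xs y∈xs = update-≢ _≟ₐ_ R.head v (λ y≡x → All.lookup x∉xs y∈xs (sym y≡x))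

    arc-isEdge : ∀ {y} → y ∈ x ∷ xs → adj H (c y) (head y) ≡ true
    arc-isEdge (here refl)  = trans (cong (adj H w) head-x) wv
    arc-isEdge (there y∈xs) = trans (cong (adj H _) (head-xs y∈xs)) (deleteEdge-⊆ H w v _ _ (R.isEdge y∈xs))

    arcs-cover : ∀ a b → adj H a b ≡ true → ∃ λ y → y ∈ x ∷ xs × Joins head y a b
    arcs-cover a b ab with adj H′ a b in ab′
    ... | true  = let y , y∈xs , joins = R.covers a b ab′
                  in y , there y∈xs , Joins-resp R.head head (sym (head-xs y∈xs)) joins
    ... | false with deleteEdge-only H w v a b ab ab′
    ...   | inj₁ (wa , vb) = x , here refl , inj₁ (wa , trans head-x vb)
    ...   | inj₂ (wb , va) = x , here refl , inj₂ (wb , trans head-x va)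

    deleted : ∀ {y a b} → y ∈ xs → Joins head x a b → Joins head y a b → ⊥
    deleted {y} {a} {b} y∈xs joins-x joins-y = case trans (sym in-H′) gone of λ ()
      where
      in-H′ : adj H′ a b ≡ true
      in-H′ = trans (Joins-adj H′ R.head (Joins-resp head R.head (head-xs y∈xs) joins-y)) (R.isEdge y∈xs)
      gone : adj H′ a b ≡ false
      gone = trans (Joins-adj H′ (λ _ → v) (Joins-resp head (λ _ → v) head-x joins-x)) (deleteEdge-deleted H w v)

    arcs-unique : ∀ {y z a b} → y ∈ x ∷ xs → z ∈ x ∷ xs → Joins head y a b → Joins head z a b → y ≡ z
    arcs-unique (here refl)  (here refl)  _  _  = refl
    arcs-unique (here refl)  (there z∈xs) jy jz = ⊥-elim (deleted z∈xs jy jz)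
    arcs-unique (there y∈xs) (here refl)  jy jz = ⊥-elim (deleted y∈xs jz jy)
    arcs-unique (there y∈xs) (there z∈xs) jy jz =
      R.unique y∈xs z∈xs (Joins-resp head R.head (head-xs y∈xs) jy) (Joins-resp head R.head (head-xs z∈xs) jz)

-- Balanced placement of the star centres

difference-≤-trans : ∀ a A b B c C → a + B ≤ b + A → b + C ≤ c + B → a + C ≤ c + A
difference-≤-trans a A b B c C a-A≤b-B b-B≤c-C = +-cancelˡ-≤ (B + b) _ _ (begin
  B + b + (a + C)      ≡⟨ shuffle₁ a A b B c C ⟩
  (a + B) + (b + C)    ≤⟨ +-mono-≤ a-A≤b-B b-B≤c-C ⟩
  (b + A) + (c + B)    ≡⟨ shuffle₂ a A b B c C ⟩
  B + b + (c + A)      ∎)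
  where
  open ≤-Reasoning
  shuffle₁ : ∀ a A b B c C → B + b + (a + C) ≡ (a + B) + (b + C)
  shuffle₁ = solve-∀
  shuffle₂ : ∀ a A b B c C → (b + A) + (c + B) ≡ B + b + (c + A)
  shuffle₂ = solve-∀

argmin-difference : ∀ {n} (P : VertexSet n) (f g : Fin n → ℕ) →
  (∃ λ m → P m ≡ true × ∀ u → P u ≡ true → f m + g u ≤ f u + g m) ⊎ (∀ u → P u ≡ false)
argmin-difference {zero}  P f g = inj₂ λ ()
argmin-difference {suc n} P f g with argmin-difference (P ∘ suc) (f ∘ suc) (g ∘ suc) | P zero in P0
... | inj₂ none | false = inj₂ λ { zero → P0 ; (suc u) → none u }
... | inj₂ none | true  =
  inj₁ (zero , P0 , λ { zero _ → ≤-refl ; (suc u) Pu → case trans (sym Pu) (none u) of λ () })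
... | inj₁ (m , Pm , best) | false =
  inj₁ (suc m , Pm , λ { zero Pu → case trans (sym Pu) P0 of λ () ; (suc u) Pu → best u Pu })
... | inj₁ (m , Pm , best) | true with f zero + g (suc m) ≤? f (suc m) + g zero
...   | yes 0≤m = inj₁ (zero , P0 , λ
        { zero _     → ≤-refl
        ; (suc u) Pu → difference-≤-trans (f zero) (g zero) (f (suc m)) (g (suc m)) (f (suc u)) (g (suc u))
                                          0≤m (best u Pu) })
...   | no  0≰m = inj₁ (suc m , Pm , λ { zero _ → <⇒≤ (≰⇒> 0≰m) ; (suc u) Pu → best u Pu })

-- The first hypothesis is the balance inequality summed over A × B, with k = |A|, m = |B|,
-- F = h, G = 2t and c = 2s.
averaging : ∀ k m FA FB GA GB c → m * FA + GB * k ≤ m * GA + (FB + c * m) * k → FA + FB ≡ GA + GB →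
  (k + m) * FA ≤ (k + m) * GA + c * k * m
averaging k m FA FB GA GB c pairs same = +-cancelʳ-≤ (GB * k) _ _ (begin
  (k + m) * FA + GB * k                  ≡⟨ shuffle₁ k m FA GB ⟩
  k * FA + (m * FA + GB * k)             ≤⟨ +-monoʳ-≤ (k * FA) pairs ⟩
  k * FA + (m * GA + (FB + c * m) * k)   ≡⟨ shuffle₂ k m FA FB GA c ⟩
  k * (FA + FB) + m * GA + c * k * m     ≡⟨ cong (λ z → k * z + m * GA + c * k * m) same ⟩
  k * (GA + GB) + m * GA + c * k * m     ≡⟨ shuffle₃ k m GA GB c ⟩
  (k + m) * GA + c * k * m + GB * k      ∎)
  where
  open ≤-Reasoning
  shuffle₁ : ∀ k m FA GB → (k + m) * FA + GB * k ≡ k * FA + (m * FA + GB * k)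
  shuffle₁ = solve-∀
  shuffle₂ : ∀ k m FA FB GA c → k * FA + (m * GA + (FB + c * m) * k) ≡ k * (FA + FB) + m * GA + c * k * m
  shuffle₂ = solve-∀
  shuffle₃ : ∀ k m GA GB c → k * (GA + GB) + m * GA + c * k * m ≡ (k + m) * GA + c * k * m + GB * k
  shuffle₃ = solve-∀

module Balancing {n : ℕ} (G : SimpleGraph n) (S : VertexSet n) (s : ℕ) where

  W : VertexSet n
  W = ∁ S

  -- h u / 2 is the fair share of u: its edges to the stable set S and half of its edges inside W.
  h : Fin n → ℕ
  h u = 2 * degreeIn G S u + degreeIn G W u

  -- 2t − h varies by at most 2s over W; differences are compared with both sides moved.
  Balanced : (Fin n → ℕ) → Set
  Balanced t = ∀ u v → S u ≡ false → S v ≡ false → 2 * t v + h u ≤ 2 * t u + h v + 2 * s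

  -- Vertices that carry no star are exempt, since their 2t − h = −h may be arbitrarily low.
  NearlyBalanced : (Fin n → ℕ) → Set
  NearlyBalanced t = ∀ v → S v ≡ false →
    t v ≡ 0 ⊎ (∀ u → S u ≡ false → 2 * t v + h u ≤ 2 * t u + h v + 2 * s)

  nearlyBalanced-resp : ∀ {t t′} → t ≗ t′ → NearlyBalanced t → NearlyBalanced t′
  nearlyBalanced-resp t≗t′ balanced v Sv with balanced v Sv
  ... | inj₁ tv≡0 = inj₁ (trans (sym (t≗t′ v)) tv≡0)
  ... | inj₂ bound = inj₂ λ u Su →
    subst₂ (λ a b → 2 * a + h u ≤ 2 * b + h v + 2 * s) (t≗t′ v) (t≗t′ u) (bound u Su)

  nearlyBalanced-step : ∀ {t m r} → NearlyBalanced t → S m ≡ false →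
    (∀ u → S u ≡ false → 2 * t m + h u ≤ 2 * t u + h m) → r ≤ s →
    NearlyBalanced (λ u → r * [ u == m ] + t u)
  nearlyBalanced-step {t} {m} {r} balanced Sm minimal r≤s v Sv with v Fin.≟ m
  ... | yes refl = inj₂ λ u Su → begin
    2 * (r * 1 + t v) + h u           ≡⟨ shuffle r (t v) (h u) ⟩
    (2 * t v + h u) + 2 * r           ≤⟨ +-mono-≤ (minimal u Su) (*-monoʳ-≤ 2 r≤s) ⟩
    (2 * t u + h v) + 2 * s
      ≤⟨ +-monoˡ-≤ (2 * s) (+-monoˡ-≤ (h v) (*-monoʳ-≤ 2 (m≤n+m (t u) (r * [ u == m ])))) ⟩
    2 * (r * [ u == v ] + t u) + h v + 2 * s ∎
    where
    open ≤-Reasoning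
    shuffle : ∀ r t h → 2 * (r * 1 + t) + h ≡ (2 * t + h) + 2 * r
    shuffle = solve-∀
  ... | no v≢m with balanced v Sv
  ...   | inj₁ tv≡0 = inj₁ (trans (cong (_+ t v) (*-zeroʳ r)) tv≡0)
  ...   | inj₂ bound = inj₂ λ u Su → begin
    2 * (r * 0 + t v) + h u           ≡⟨ cong (λ k → 2 * (k + t v) + h u) (*-zeroʳ r) ⟩
    2 * t v + h u                     ≤⟨ bound u Su ⟩
    2 * t u + h v + 2 * s
      ≤⟨ +-monoˡ-≤ (2 * s) (+-monoˡ-≤ (h v) (*-monoʳ-≤ 2 (m≤n+m (t u) (r * [ u == m ])))) ⟩
    2 * (r * [ u == m ] + t u) + h v + 2 * s ∎
    where open ≤-Reasoning

  record Placement {A : Set} (sz : A → ℕ) (xs : List A) : Set where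
    constructor placement
    field
      centre         : A → Fin n
      centre-outside : ∀ {x} → x ∈ xs → S (centre x) ≡ false
      nearlyBalanced : NearlyBalanced (load centre sz xs)

  greedy : ∀ {A : Set} → DecidableEquality A → (sz : A → ℕ) → (∀ x → sz x ≤ s) →
    (A → ∃ λ w → S w ≡ false) → ∀ xs → Unique xs → Placement sz xs
  greedy _≟ₐ_ sz sz≤s outside [] _ = placement (proj₁ ∘ outside) (λ ()) (λ _ _ → inj₁ refl)
  greedy _≟ₐ_ sz sz≤s outside (x ∷ xs) (x∉xs ∷ unique-xs)
    with greedy _≟ₐ_ sz sz≤s outside xs unique-xs
  ... | placement c c-outside balanced
    with argmin-difference W (λ u → 2 * load c sz xs u) h
  ...   | inj₂ W-empty =
    ⊥-elim (case trans (sym (cong not (proj₂ (outside x)))) (W-empty (proj₁ (outside x))) of λ ())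
  ...   | inj₁ (m , Wm , minimal) = placement c′ c′-outside (nearlyBalanced-resp load≗ step)
    where
    c′ = update _≟ₐ_ c x m
    c′≡c : ∀ {y} → y ∈ xs → c′ y ≡ c y
    c′≡c y∈xs = update-≢ _≟ₐ_ c m (λ y≡x → All.lookup x∉xs y∈xs (sym y≡x))
    Sm : S m ≡ false
    Sm = not-injective Wm
    c′-outside : ∀ {y} → y ∈ x ∷ xs → S (c′ y) ≡ false
    c′-outside (here refl)  = trans (cong S (update-≡ _≟ₐ_ c x m)) Sm
    c′-outside (there y∈xs) = trans (cong S (c′≡c y∈xs)) (c-outside y∈xs)
    step : NearlyBalanced (λ u → sz x * [ u == m ] + load c sz xs u)
    step = nearlyBalanced-step balanced Sm (λ u Su → minimal u (cong not Su)) (sz≤s x)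
    load≗ : (λ u → sz x * [ u == m ] + load c sz xs u) ≗ load c′ sz (x ∷ xs)
    load≗ u = cong₂ (λ w k → sz x * [ u == w ] + k) (sym (update-≡ _≟ₐ_ c x m))
                    (sym (load-cong sz xs c′≡c u))

  balanced : ∀ {t} → NearlyBalanced t → weight W (λ u → 2 * t u) ≡ weight W h → Balanced t
  balanced {t} nearly same-weight u v Su Sv with nearly v Sv
  ... | inj₂ bound = bound u Su
  ... | inj₁ tv≡0 with h u ≤? 2 * t u + h v + 2 * s
  ...   | yes hu≤ = subst (λ k → 2 * k + h u ≤ 2 * t u + h v + 2 * s) (sym tv≡0) hu≤
  ...   | no  hu≰ = ⊥-elim (<-irrefl same-weight (weight-mono-< W below u (cong not Su) 2tu<hu))
    where
    2tu+2s<hu : 2 * t u + 2 * s < h u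
    2tu+2s<hu = ≤-<-trans (+-monoˡ-≤ (2 * s) (m≤m+n (2 * t u) (h v))) (≰⇒> hu≰)
    2tu<hu : 2 * t u < h u
    2tu<hu = ≤-<-trans (m≤m+n (2 * t u) (2 * s)) 2tu+2s<hu
    below : ∀ w → W w ≡ true → 2 * t w ≤ h w
    below w Ww with nearly w (not-injective Ww)
    ... | inj₁ tw≡0 rewrite tw≡0 = z≤n
    ... | inj₂ bound = <⇒≤ (+-cancelʳ-< (h u) _ _ (begin-strict
      2 * t w + h u             ≤⟨ bound u Su ⟩
      2 * t u + h w + 2 * s     ≡⟨ shuffle (2 * t u) (h w) (2 * s) ⟩
      (2 * t u + 2 * s) + h w   <⟨ +-monoˡ-< (h w) 2tu+2s<hu ⟩
      h u + h w                 ≡⟨ +-comm (h u) (h w) ⟩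
      h w + h u                 ∎))
      where
      open ≤-Reasoning
      shuffle : ∀ a b c → a + b + c ≡ (a + c) + b
      shuffle = solve-∀

  W∖-splits : ∀ {A} → (∀ v → A v ≡ true → S v ≡ false) → Splits W A (W ∖ A)
  W∖-splits {A} A⊆W = splits pointwise
    where
    pointwise : ∀ u → [ not (S u) ] ≡ [ A u ] + [ not (S u) ∧ not (A u) ]
    pointwise u with A u in Au | S u in Su
    ... | true  | true  = case trans (sym Su) (A⊆W u Au) of λ ()
    ... | true  | false = refl
    ... | false | true  = refl
    ... | false | false = refl

  full-splits : Splits full W S
  full-splits = splits (λ u → pointwise (S u))
    where
    pointwise : ∀ b → [ true ] ≡ [ not b ] + [ b ]
    pointwise false = refl
    pointwise true  = refl

  ∩-splits : ∀ X → Splits X (X ∩ W) (X ∩ S)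
  ∩-splits X = splits (λ u → pointwise (X u) (S u))
    where
    pointwise : ∀ x b → [ x ] ≡ [ x ∧ not b ] + [ x ∧ b ]
    pointwise false _     = refl
    pointwise true  false = refl
    pointwise true  true  = refl

  weight-h : ∀ A → weight A h ≡ 2 * edgesBetween G A S + edgesBetween G A W
  weight-h A = trans (weight-distrib-+ A _ _) (cong₂ _+_
    (trans (weight-scale A 2 _) (cong (2 *_) (sym (edgesBetween-weight G A S))))
    (sym (edgesBetween-weight G A W)))

  expansion-everywhere : LeExpansionMinus s G S → ∀ A → (∀ v → A v ≡ true → S v ≡ false) →
    2 * s * card A * card (W ∖ A) ≤ card W * edgesBetween G A (W ∖ A)
  expansion-everywhere expansion A A⊆W with card-zero-or-member A | card-zero-or-member (W ∖ A)
  ... | inj₁ cA≡0 | _ = subst (_≤ card W * edgesBetween G A (W ∖ A)) (sym (begin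
    2 * s * card A * card (W ∖ A)  ≡⟨ cong (λ k → 2 * s * k * card (W ∖ A)) cA≡0 ⟩
    2 * s * 0 * card (W ∖ A)       ≡⟨ cong (_* card (W ∖ A)) (*-zeroʳ (2 * s)) ⟩
    0                              ∎)) z≤n
    where open ≡-Reasoning
  ... | inj₂ _ | inj₁ cB≡0 = subst (_≤ card W * edgesBetween G A (W ∖ A))
                                     (sym (trans (cong (2 * s * card A *_) cB≡0) (*-zeroʳ (2 * s * card A)))) z≤n
  ... | inj₂ member | inj₂ (v , Bv) =
    expansion A A⊆W member (v , not-injective (∧-conicalʳ _ _ Bv) , not-injective (∧-conicalˡ _ _ Bv))

  fair-share-bound : ∀ {t} → LeExpansionMinus s G S → Balanced t → weight W (λ u → 2 * t u) ≡ weight W h →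
    ∀ A → (∀ v → A v ≡ true → S v ≡ false) → weight A h ≤ 2 * weight A t + edgesBetween G A (W ∖ A)
  fair-share-bound {t} expansion balanced′ same-weight A A⊆W with card-zero-or-member A
  ... | inj₁ cA≡0 =
    subst (_≤ 2 * weight A t + edgesBetween G A (W ∖ A)) (sym (card-zero⇒weight-zero A h cA≡0)) z≤n
  ... | inj₂ (a , Aa) = *-cancelˡ-≤ (k + m) {{>-nonZero 0<k+m}} (begin
    (k + m) * FA                               ≤⟨ averaging k m FA FB GA GB (2 * s) pairs same ⟩
    (k + m) * GA + 2 * s * k * m
      ≤⟨ +-monoʳ-≤ ((k + m) * GA)
                   (subst (λ z → 2 * s * k * m ≤ z * e) |W| (expansion-everywhere expansion A A⊆W)) ⟩
    (k + m) * GA + (k + m) * e                 ≡⟨ sym (*-distribˡ-+ (k + m) GA e) ⟩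
    (k + m) * (GA + e)                         ≡⟨ cong (λ z → (k + m) * (z + e)) (weight-scale A 2 t) ⟩
    (k + m) * (2 * weight A t + e)             ∎)
    where
    open ≤-Reasoning
    B = W ∖ A
    k = card A
    m = card B
    e = edgesBetween G A B
    FA = weight A h
    FB = weight B h
    GA = weight A (λ u → 2 * t u)
    GB = weight B (λ u → 2 * t u)
    split = W∖-splits A⊆W
    |W| : card W ≡ k + m
    |W| = card-split split
    0<k+m : 0 < k + m
    0<k+m = ≤-trans (≤-reflexive (cong [_] (sym Aa)))
                    (≤-trans (term≤sumFin n (λ u → [ A u ]) a) (m≤m+n k m))
    B⊆W : ∀ {v} → B v ≡ true → S v ≡ false
    B⊆W Bv = not-injective (∧-conicalˡ _ _ Bv)
    pairs : m * FA + GB * k ≤ m * GA + (FB + 2 * s * m) * k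
    pairs = begin
      m * FA + GB * k
        ≡⟨ sym (weight-pairs A B h (λ v → 2 * t v)) ⟩
      weight A (λ u → weight B (λ v → h u + 2 * t v))
        ≤⟨ weight-mono-≤ A (λ u Au → weight-mono-≤ B (λ v Bv →
             subst₂ _≤_ (+-comm (2 * t v) (h u)) (+-assoc (2 * t u) (h v) (2 * s))
                        (balanced′ u v (A⊆W u Au) (B⊆W Bv)))) ⟩
      weight A (λ u → weight B (λ v → 2 * t u + (h v + 2 * s)))
        ≡⟨ weight-pairs A B (λ u → 2 * t u) (λ v → h v + 2 * s) ⟩
      m * GA + weight B (λ v → h v + 2 * s) * k
        ≡⟨ cong (λ z → m * GA + z * k)
                (trans (weight-distrib-+ B h (λ _ → 2 * s)) (cong (FB +_) (weight-const B (2 * s)))) ⟩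
      m * GA + (FB + 2 * s * m) * k ∎
    same : FA + FB ≡ GA + GB
    same = trans (sym (weight-split split h)) (trans (sym same-weight) (weight-split split (λ u → 2 * t u)))

  module _ (stable : Stable G S) where

    weight-h-W : weight W h ≡ 2 * numEdges G
    weight-h-W = begin
      weight W h                                             ≡⟨ weight-h W ⟩
      2 * e W S + e W W                                      ≡⟨ shuffle (e W S) (e W W) ⟩
      e W W + e W S + e W S + 0
        ≡⟨ cong₂ (λ a b → e W W + e W S + a + b) (edgesBetween-comm G W S) (sym (edgesBetween-stable G stable)) ⟩
      e W W + e W S + e S W + e S S                          ≡⟨ sym (edgesBetween-square G full-splits) ⟩
      e full full                                            ≡⟨ edgesBetween-full G ⟩
      2 * numEdges G                                         ∎
      where
      open ≡-Reasoning
      e = edgesBetween G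
      shuffle : ∀ a b → 2 * a + b ≡ b + a + a + 0
      shuffle = solve-∀

    weight-2t≡weight-h : ∀ {t} → (∀ u → S u ≡ true → t u ≡ 0) → sumFin n t ≡ numEdges G →
      weight W (λ u → 2 * t u) ≡ weight W h
    weight-2t≡weight-h {t} t-outside Σt≡E = begin
      weight W (λ u → 2 * t u)        ≡⟨ weight-scale W 2 t ⟩
      2 * weight W t                  ≡⟨ cong (2 *_) (sym (+-identityʳ (weight W t))) ⟩
      2 * (weight W t + 0)            ≡⟨ cong (λ k → 2 * (weight W t + k)) (sym (weight-vanishing S t t-outside)) ⟩
      2 * (weight W t + weight S t)   ≡⟨ cong (2 *_) (sym (weight-split full-splits t)) ⟩
      2 * weight full t               ≡⟨ cong (2 *_) (trans (weight-full t) Σt≡E) ⟩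
      2 * numEdges G                  ≡⟨ sym weight-h-W ⟩
      weight W h                      ∎
      where open ≡-Reasoning

    hakimi-from-expansion : ∀ {t} → LeExpansionMinus s G S → (∀ u → S u ≡ true → t u ≡ 0) →
      sumFin n t ≡ numEdges G → Balanced t → Hakimi G t
    hakimi-from-expansion {t} expansion t-outside Σt≡E balanced′ = record { sparse = sparse ; total = total }
      where
      e = edgesBetween G

      total : e full full ≡ 2 * weight full t
      total = trans (edgesBetween-full G) (cong (2 *_) (sym (trans (weight-full t) Σt≡E)))

      sparse : ∀ X → e X X ≤ 2 * weight X t
      sparse X = +-cancelʳ-≤ (e A B) _ _ (begin
        e X X + e A B                  ≤⟨ +-monoˡ-≤ (e A B) inside ⟩
        e A A + 2 * e A S + e A B      ≡⟨ shuffle₁ (e A A) (e A S) (e A B) ⟩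
        2 * e A S + (e A A + e A B)    ≡⟨ cong (2 * e A S +_) (sym (edgesBetween-splitʳ G (W∖-splits A⊆W) A)) ⟩
        2 * e A S + e A W              ≡⟨ sym (weight-h A) ⟩
        weight A h
          ≤⟨ fair-share-bound expansion balanced′ (weight-2t≡weight-h t-outside Σt≡E) A A⊆W ⟩
        2 * weight A t + e A B         ≡⟨ cong (λ k → 2 * k + e A B) weight-A ⟩
        2 * weight X t + e A B         ∎)
        where
        open ≤-Reasoning
        A = X ∩ W
        XS = X ∩ S
        B = W ∖ A
        shuffle₁ : ∀ a b c → a + 2 * b + c ≡ 2 * b + (a + c)
        shuffle₁ = solve-∀
        shuffle₂ : ∀ a b → a + b + b + 0 ≡ a + 2 * b
        shuffle₂ = solve-∀
        A⊆W : ∀ v → A v ≡ true → S v ≡ false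
        A⊆W v Av = not-injective (∧-conicalʳ _ _ Av)
        XS⊆S : XS ⊆ S
        XS⊆S v = ∧-conicalʳ _ _
        inside : e X X ≤ e A A + 2 * e A S
        inside = begin
          e X X                               ≡⟨ edgesBetween-square G (∩-splits X) ⟩
          e A A + e A XS + e XS A + e XS XS
            ≤⟨ +-mono-≤ (+-mono-≤ (+-monoʳ-≤ (e A A) (edgesBetween-mono G {A = A} (λ _ a → a) XS⊆S))
                                  (≤-trans (≤-reflexive (edgesBetween-comm G XS A))
                                           (edgesBetween-mono G {A = A} (λ _ a → a) XS⊆S)))
                        (≤-trans (edgesBetween-mono G XS⊆S XS⊆S) (≤-reflexive (edgesBetween-stable G stable))) ⟩
          e A A + e A S + e A S + 0           ≡⟨ shuffle₂ (e A A) (e A S) ⟩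
          e A A + 2 * e A S                   ∎
        weight-A : weight A t ≡ weight X t
        weight-A = sym (begin-equality
          weight X t                          ≡⟨ weight-split (∩-splits X) t ⟩
          weight A t + weight XS t
            ≡⟨ cong (weight A t +_) (weight-vanishing XS t (λ u XSu → t-outside u (XS⊆S u XSu))) ⟩
          weight A t + 0                      ≡⟨ +-identityʳ _ ⟩
          weight A t                          ∎)

-- Enumerating stars and their edges

module _ {A : Set} (r : A → ℕ) where

  tag : (x : A) → Fin (r x) → Σ A (Fin ∘ r)
  tag x l = x , l

  fibre : (x : A) → List (Σ A (Fin ∘ r))
  fibre x = List.map (tag x) (List.allFin (r x))

  pairsOver : List A → List (Σ A (Fin ∘ r))
  pairsOver []       = []
  pairsOver (x ∷ xs) = fibre x ++ pairsOver xs

  ∈-pairsOver : ∀ {xs x} (l : Fin (r x)) → x ∈ xs → (x , l) ∈ pairsOver xs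
  ∈-pairsOver {x ∷ xs} l (here refl)  = ∈-++⁺ˡ (∈-map⁺ (tag x) (∈-allFin l))
  ∈-pairsOver {x ∷ xs} l (there x∈xs) = ∈-++⁺ʳ (fibre x) (∈-pairsOver l x∈xs)

  pairsOver-proj₁ : ∀ xs {p} → p ∈ pairsOver xs → proj₁ p ∈ xs
  pairsOver-proj₁ (x ∷ xs) p∈ with ∈-++⁻ (fibre x) p∈
  ... | inj₁ p∈x  = let _ , _ , p≡ = ∈-map⁻ (tag x) p∈x in here (cong proj₁ p≡)
  ... | inj₂ p∈xs = there (pairsOver-proj₁ xs p∈xs)

  pairsOver-unique : ∀ {xs} → Unique xs → Unique (pairsOver xs)
  pairsOver-unique {[]}     _                   = []
  pairsOver-unique {x ∷ xs} (x∉xs ∷ unique-xs) =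
    Unique.++⁺ (Unique.map⁺ (λ { refl → refl }) (Unique.allFin⁺ (r x))) (pairsOver-unique unique-xs) disjoint
    where
    disjoint : ∀ {p} → ¬ (p ∈ fibre x × p ∈ pairsOver xs)
    disjoint (p∈x , p∈xs) with ∈-map⁻ (tag x) p∈x
    ... | _ , _ , refl = All.lookup x∉xs (pairsOver-proj₁ xs p∈xs) refl

  load-pairsOver : ∀ {n} (c : A → Fin n) xs → load (c ∘ proj₁) (λ _ → 1) (pairsOver xs) ≗ load c r xs
  load-pairsOver c []       u = refl
  load-pairsOver c (x ∷ xs) u = trans (load-++ (fibre x) u)
    (cong₂ _+_ (trans (load-fibre (List.allFin (r x))) (cong (_* [ u == c x ]) (List.length-tabulate {n = r x} id)))
               (load-pairsOver c xs u))
    where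
    load-++ : ∀ ys u → load (c ∘ proj₁) (λ _ → 1) (ys ++ pairsOver xs) u ≡
                       load (c ∘ proj₁) (λ _ → 1) ys u + load (c ∘ proj₁) (λ _ → 1) (pairsOver xs) u
    load-++ []       u = refl
    load-++ (y ∷ ys) u =
      trans (cong (1 * [ u == c (proj₁ y) ] +_) (load-++ ys u)) (sym (+-assoc (1 * [ u == c (proj₁ y) ]) _ _))
    load-fibre : ∀ (ls : List (Fin (r x))) →
      load (c ∘ proj₁) (λ _ → 1) (List.map (tag x) ls) u ≡ List.length ls * [ u == c x ]
    load-fibre []       = refl
    load-fibre (l ∷ ls) = cong₂ _+_ (*-identityˡ _) (load-fibre ls)

  sum-map-pairsOver : ∀ xs (f : A → ℕ) →
    sum (List.map (f ∘ proj₁) (pairsOver xs)) ≡ sum (List.map (λ x → r x * f x) xs)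
  sum-map-pairsOver []       f = refl
  sum-map-pairsOver (x ∷ xs) f = begin
    sum (List.map (f ∘ proj₁) (fibre x ++ pairsOver xs))
      ≡⟨ cong sum (List.map-++ (f ∘ proj₁) (fibre x) (pairsOver xs)) ⟩
    sum (List.map (f ∘ proj₁) (fibre x) ++ List.map (f ∘ proj₁) (pairsOver xs))
      ≡⟨ sum-++ (List.map (f ∘ proj₁) (fibre x)) (List.map (f ∘ proj₁) (pairsOver xs)) ⟩
    sum (List.map (f ∘ proj₁) (fibre x)) + sum (List.map (f ∘ proj₁) (pairsOver xs))
      ≡⟨ cong₂ _+_ (trans (sum-fibre (List.allFin (r x))) (cong (_* f x) (List.length-tabulate {n = r x} id)))
                   (sum-map-pairsOver xs f) ⟩
    r x * f x + sum (List.map (λ x → r x * f x) xs) ∎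
    where
    open ≡-Reasoning
    sum-fibre : ∀ (ls : List (Fin (r x))) → sum (List.map (f ∘ proj₁) (List.map (tag x) ls)) ≡ List.length ls * f x
    sum-fibre []       = refl
    sum-fibre (_ ∷ ls) = cong (f x +_) (sum-fibre ls)

sum-map-allFin : ∀ d (f : Fin d → ℕ) → sum (List.map f (List.allFin d)) ≡ sumFin d f
sum-map-allFin d f = trans (cong sum (List.map-tabulate id f)) (sum-tabulate d f)
  where
  sum-tabulate : ∀ d (f : Fin d → ℕ) → sum (List.tabulate f) ≡ sumFin d f
  sum-tabulate zero    f = refl
  sum-tabulate (suc d) f = cong (f zero +_) (sum-tabulate d (f ∘ suc))

attained-upper-bound : ∀ {P : ℕ → Set} d (f : Fin d → ℕ) → P 0 → (∀ i → P (f i)) →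
  ∃ λ m → P m × ∀ i → f i ≤ m
attained-upper-bound zero    f P0 Pf = 0 , P0 , λ ()
attained-upper-bound (suc d) f P0 Pf with attained-upper-bound d (f ∘ suc) P0 (Pf ∘ suc)
... | m , Pm , f≤m with f zero ≤? m
...   | yes f0≤m = m , Pm , λ { zero → f0≤m ; (suc i) → f≤m i }
...   | no  f0≰m = f zero , Pf zero , λ { zero → ≤-refl ; (suc i) → ≤-trans (f≤m i) (<⇒≤ (≰⇒> f0≰m)) }

module Stars (d : ℕ) (s a : Fin d → ℕ) where

  Star : Set
  Star = Σ (Fin d) (Fin ∘ a)

  size : Star → ℕ
  size = s ∘ proj₁

  _≟★_ : DecidableEquality Star
  _≟★_ = Σ.≡-dec Fin._≟_ Fin._≟_

  stars : List Star
  stars = pairsOver a (List.allFin d)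

  ∈-stars : ∀ i k → (i , k) ∈ stars
  ∈-stars i k = ∈-pairsOver a k (∈-allFin i)

  stars-unique : Unique stars
  stars-unique = pairsOver-unique a (Unique.allFin⁺ d)

  sumFin-load-stars : ∀ {n} (c : Star → Fin n) → sumFin n (load c size stars) ≡ sumFin d (λ i → a i * s i)
  sumFin-load-stars {n} c = begin
    sumFin n (load c size stars)                       ≡⟨ sumFin-load c size stars ⟩
    sum (List.map size stars)                          ≡⟨ sum-map-pairsOver a (List.allFin d) s ⟩
    sum (List.map (λ i → a i * s i) (List.allFin d))   ≡⟨ sum-map-allFin d _ ⟩
    sumFin d (λ i → a i * s i)                         ∎
    where open ≡-Reasoning

  slots : List (Σ Star (Fin ∘ size))
  slots = pairsOver size stars

  ∈-slots : ∀ i k l → ((i , k) , l) ∈ slots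
  ∈-slots i k l = ∈-pairsOver size l (∈-stars i k)

  _≟slot_ : DecidableEquality (Σ Star (Fin ∘ size))
  _≟slot_ = Σ.≡-dec _≟★_ Fin._≟_

  orientation⇒starDecomposition : ∀ {n} {G : SimpleGraph n} (c : Star → Fin n) →
    Orientation _≟slot_ (c ∘ proj₁) G slots → StarDecomposition G d s a
  orientation⇒starDecomposition c arcs = record
    { center = λ i k → c (i , k)
    ; leaf   = λ i k l → arcs.head ((i , k) , l)
    ; isEdge = λ i k l → arcs.isEdge (∈-slots i k l)
    ; covers = λ u v uv → let ((i , k) , l) , _ , joins = arcs.covers u v uv in (i , k , l) , joins
    ; unique = λ { u v (i , k , l) (i′ , k′ , l′) j j′ →
                   case arcs.unique (∈-slots i k l) (∈-slots i′ k′ l′) j j′ of λ { refl → refl } }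
    }
    where module arcs = Orientation arcs

expansion⇒starDecomposition : ∀ {n} (G : SimpleGraph n) d (s a : Fin d → ℕ) →
  (∀ i → 1 ≤ s i) → (∀ i → 1 ≤ a i) → sumFin d (λ i → a i * s i) ≡ numEdges G →
  (S : VertexSet n) → Stable G S → ∀ smax → (∀ i → s i ≤ smax) → LeExpansionMinus smax G S →
  Σ (StarDecomposition G d s a) (λ D → CentersAvoid D S)
expansion⇒starDecomposition {n} G d s a 1≤s 1≤a Σas≡E S stable smax s≤smax expansion =
  orientation⇒starDecomposition centre arcs , λ i k → centre-outside (∈-stars i k)
  where
  open Stars d s a
  open Balancing G S smax

  outside : Star → ∃ λ w → S w ≡ false
  outside (i , _) = stable-complement-nonempty G stable
    (≤-trans (*-mono-≤ (1≤a i) (1≤s i)) (subst (a i * s i ≤_) Σas≡E (term≤sumFin d (λ i → a i * s i) i)))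

  open Placement (greedy _≟★_ size (s≤smax ∘ proj₁) outside stars stars-unique)

  t-outside : ∀ u → S u ≡ true → load centre size stars u ≡ 0
  t-outside u Su = load-vanishing centre size stars u
    (λ x∈ u≡cx → case trans (sym Su) (trans (cong S u≡cx) (centre-outside x∈)) of λ ())

  Σt≡E : sumFin n (load centre size stars) ≡ numEdges G
  Σt≡E = trans (sumFin-load-stars centre) Σas≡E

  hakimi : Hakimi G (load centre size stars)
  hakimi = hakimi-from-expansion stable expansion t-outside Σt≡E
             (balanced nearlyBalanced (weight-2t≡weight-h stable t-outside Σt≡E))

  arcs : Orientation _≟slot_ (centre ∘ proj₁) G slots
  arcs = orientation _≟slot_ (centre ∘ proj₁) slots (pairsOver-unique size stars-unique) G
           (Hakimi-resp (λ u → sym (load-pairsOver size centre stars u)) hakimi)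

lemma1 : {n : ℕ} (G : SimpleGraph n) (d : ℕ) (s a : Fin d → ℕ) →
    (∀ i → 1 ≤ s i) → (∀ i → 1 ≤ a i) →
    sumFin d (λ i → a i * s i) ≡ numEdges G →
    (S : Fin n → Bool) → Stable G S →
    (∀ i → LeExpansionMinus (s i) G S) →
    StarDecomposition G d s a
      × Σ (StarDecomposition G d s a) (λ D → CentersAvoid D S)
lemma1 G d s a 1≤s 1≤a Σas≡E S stable expansion = proj₁ decomposition , decomposition
  where
  -- When there are no star types (d = 0) the bound is 0, for which the expansion condition is trivial.
  smax = attained-upper-bound {P = λ m → LeExpansionMinus m G S} d s (λ _ _ _ _ → z≤n) expansion
  decomposition = expansion⇒starDecomposition G d s a 1≤s 1≤a Σas≡E S stable
                    (proj₁ smax) (proj₂ (proj₂ smax)) (proj₁ (proj₂ smax))
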